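{- Let $A$ be a connected graph whose vertex set is partitioned as $V(A)=A^1\cup A^2\cup\cdots\cup A^m$, where for each $i$ the number $|A^i|$ is even, the subgraph of $A$ induced by $A^i$ is $d_i$-regular for some $d_i\geq |A^i|/2$, and each vertex $a\in A^i$ is adjacent (in $A$) to all or none of the vertices of $A^j$, for each $j\neq i$. For each $i\in\{1,\dots,m\}$ let $B^i$ be a collection of connected graphs $B^i_1,\dots,B^i_{\ell_i}$ (pairwise vertex-disjoint and vertex-disjoint from $A$), and for each $B^i_j$ select a subset $A^i_j\subseteq A^i$ with $|A^i_j|=|A^i|/2$. Let $G_1$ be a connected graph with vertex set $V(A)\cup\bigcup_{i,j}V(B^i_j)$ whose edges are the edges of $A$, the edges of the graphs $B^i_j$, and edges between vertices of $B^i_j$ and vertices of $A^i$, such that each vertex $b\in V(B^i_j)$ is adjacent to none of the vertices of $A^i$, to all of them, or to exactly the vertices of $A^i_j$. Let $G_2$ be the graph obtained from $G_1$ by replacing, for each vertex $b\in V(B^i_j)$ whose set of neighbors in $A^i$ is exactly $A^i_j$, these edges by edges from $b$ to every vertex of $A^i\setminus A^i_j$ (all other edges unchanged), and assume $G_2$ is connected. Then $G_1$ and $G_2$ are cospectral for the distance matrix.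
   Context: For a connected graph $G$, the distance $\mathrm{dist}(u,v)$ is the number of edges of a shortest path between $u$ and $v$. The distance matrix $\mathcal{D}^G$ has $(u,v)$ entry $\mathrm{dist}(u,v)$. Two graphs are cospectral for a matrix representation if their matrices have the same multiset of eigenvalues. A graph is $d$-regular if every vertex has degree $d$. -}

module Defs where

open import Data.Nat using (ℕ; zero; suc; _≤_; _*_)
open import Data.Nat.Divisibility using (_∣_)
open import Data.Integer as ℤ using (ℤ; +_; -_)
open import Data.Fin using (Fin; zero; suc; punchIn; _≟_)
open import Data.Bool using (Bool; true; false; _∧_; _∨_; not; if_then_else_; T)
open import Data.Product using (Σ; _×_; _,_; ∃)
open import Data.Sum using (_⊎_)
open import Data.Unit using (⊤)
open import Relation.Nullary using (¬_)
open import Relation.Nullary.Decidable using (⌊_⌋)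
open import Relation.Binary.PropositionalEquality using (_≡_)

sumFin : ∀ {n} → (Fin n → ℤ) → ℤ
sumFin {zero}  f = + 0
sumFin {suc n} f = f zero ℤ.+ sumFin (λ i → f (suc i))

count : ∀ {n} → (Fin n → Bool) → ℕ
count {zero}  f = 0
count {suc n} f = (if f zero then 1 else 0) Data.Nat.+ count (λ i → f (suc i))

allB : ∀ {n} → (Fin n → Bool) → Bool
allB {zero}  f = true
allB {suc n} f = f zero ∧ allB (λ i → f (suc i))

sgn : ℕ → ℤ
sgn zero    = + 1
sgn (suc k) = - sgn k

toℕ' : ∀ {n} → Fin n → ℕ
toℕ' zero    = 0
toℕ' (suc i) = suc (toℕ' i)

det : ∀ {n} → (Fin n → Fin n → ℤ) → ℤ
det {zero}  M = + 1
det {suc n} M =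
  sumFin (λ j → sgn (toℕ' j) ℤ.* (M zero j ℤ.* det (λ r c → M (suc r) (punchIn j c))))

δ : ∀ {n} → Fin n → Fin n → ℤ
δ r c = if ⌊ r ≟ c ⌋ then + 1 else + 0

charPoly : ∀ {n} → (Fin n → Fin n → ℕ) → ℤ → ℤ
charPoly D t = det (λ r c → (t ℤ.* δ r c) ℤ.- (+ D r c))

Adj : ℕ → Set
Adj n = Fin n → Fin n → Bool

SimpleGraph : ∀ {n} → Adj n → Set
SimpleGraph {n} adj = (∀ u v → adj u v ≡ adj v u) × (∀ v → adj v v ≡ false)

data WalkIn {n} (adj : Adj n) (P : Fin n → Set) : Fin n → Fin n → ℕ → Set where
  here : ∀ {u} → P u → WalkIn adj P u u 0
  step : ∀ {u w v k} → P u → adj u w ≡ true → WalkIn adj P w v k →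
         WalkIn adj P u v (suc k)

Walk : ∀ {n} → Adj n → Fin n → Fin n → ℕ → Set
Walk adj = WalkIn adj (λ _ → ⊤)

Connected : ∀ {n} → Adj n → Set
Connected {n} adj = ∀ (u v : Fin n) → ∃ λ k → Walk adj u v k

InducedConnected : ∀ {n} → Adj n → (Fin n → Set) → Set
InducedConnected {n} adj P = ∀ (u v : Fin n) → P u → P v → ∃ λ k → WalkIn adj P u v k

IsDistanceMatrix : ∀ {n} → Adj n → (Fin n → Fin n → ℕ) → Set
IsDistanceMatrix adj D =
  ∀ u v → Walk adj u v (D u v) × (∀ k → Walk adj u v k → D u v ≤ k)

DistanceCospectral : ∀ {n} → Adj n → Adj n → Set
DistanceCospectral {n} adj₁ adj₂ =
  ∀ (D₁ D₂ : Fin n → Fin n → ℕ) → IsDistanceMatrix adj₁ D₁ → IsDistanceMatrix adj₂ D₂ →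
  ∀ (t : ℤ) → charPoly D₁ t ≡ charPoly D₂ t

data Part (m : ℕ) (ℓ : Fin m → ℕ) : Set where
  inA : Fin m → Part m ℓ
  inB : (i : Fin m) → Fin (ℓ i) → Part m ℓ

module Construction {n m : ℕ} {ℓ : Fin m → ℕ}
    (part : Fin n → Part m ℓ)
    (sel  : (i : Fin m) → Fin (ℓ i) → Fin n → Bool)
    (G₁   : Adj n) where

  isA : Fin m → Fin n → Bool
  isA i v with part v
  ... | inA i' = ⌊ i ≟ i' ⌋
  ... | inB _ _ = false

  IsA : Fin m → Fin n → Set
  IsA i v = part v ≡ inA i

  IsAny-A : Fin n → Set
  IsAny-A v = Σ (Fin m) λ i → part v ≡ inA i

  sizeA : Fin m → ℕ
  sizeA i = count (isA i)

  degIn : Fin m → Fin n → ℕ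
  degIn i v = count (λ w → G₁ v w ∧ isA i w)

  -- b is a vertex of some B^i_j whose neighbourhood in A^i is exactly A^i_j
  switched : Fin n → Bool
  switched b with part b
  ... | inA _ = false
  ... | inB i j = allB (λ w → if isA i w then (if G₁ b w then sel i j w else not (sel i j w)) else true)

  affected : Fin n → Fin n → Bool
  affected u v with part u
  ... | inA _ = false
  ... | inB i j = switched u ∧ isA i v

  newEdge : Fin n → Fin n → Bool
  newEdge u v with part u
  ... | inA _ = false
  ... | inB i j = not (sel i j v)

  G₂ : Adj n
  G₂ u v = if affected u v then newEdge u v
           else if affected v u then newEdge v u
           else G₁ u v

  record Hypotheses : Set where
    field
      simple      : SimpleGraph G₁
      G₁-conn     : Connected G₁
      A-conn      : InducedConnected G₁ IsAny-A
      A-even      : ∀ i → 2 ∣ sizeA i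
      A-regular   : ∀ i → Σ ℕ λ d → (sizeA i ≤ 2 * d) × (∀ v → IsA i v → degIn i v ≡ d)
      A-modules   : ∀ i j → ¬ (i ≡ j) → ∀ v → IsA i v →
                      (∀ w → IsA j w → G₁ v w ≡ true) ⊎ (∀ w → IsA j w → G₁ v w ≡ false)
      B-conn      : ∀ i j → InducedConnected G₁ (λ v → part v ≡ inB i j)
      B-B         : ∀ u v i j i' j' → part u ≡ inB i j → part v ≡ inB i' j' →
                      ¬ (_≡_ {A = Part m ℓ} (inB i j) (inB i' j')) → G₁ u v ≡ false
      B-otherA    : ∀ u v i j i' → part u ≡ inB i j → part v ≡ inA i' → ¬ (i ≡ i') →
                      G₁ u v ≡ false
      sel-sub     : ∀ i j v → sel i j v ≡ true → IsA i v
      sel-half    : ∀ i j → 2 * count (sel i j) ≡ sizeA i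
      B-A         : ∀ b i j → part b ≡ inB i j →
                      (∀ w → IsA i w → G₁ b w ≡ false) ⊎
                      (∀ w → IsA i w → G₁ b w ≡ true) ⊎
                      (∀ w → IsA i w → G₁ b w ≡ sel i j w)
      G₂-conn     : Connected G₂

-- Let Q act as (2 / |A^i|) J − I on each block A^i and as the identity on the vertices of the B^i_j;
-- Q is an involution. Distances inside A, inside B, and from B^i_j to A^k (k ≠ i) are the same in
-- G₁ and G₂, since every A^i has diameter at most 2 (by d_i ≥ |A^i| / 2) and is a module for the
-- rest of A. Seen from a vertex of B^i_j, the distances to A^i are either constant or take the
-- values f on one half A^i_j and f + 1 on the other, and the switching exchanges the two halves.
-- Together with the regularity of A^i this gives Q D₁ = D₂ Q. Over ℤ one uses P = H Q for a common
-- multiple H of the |A^i| / 2; then P² = H² I, so det P ≠ 0 cancels from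
-- det P · det (t I − D₁) = det (t I − D₂) · det P.
module Submission where

open import Defs
open import Data.Nat using (ℕ)
open import Data.Fin using (Fin)
open import Data.Bool using (Bool)

module Sums where
  open import Data.Nat using (zero; suc)
  open import Data.Integer using (ℤ; -_; _+_; _*_; 0ℤ; 1ℤ)
  import Data.Integer.Properties as ℤP
  open import Data.Fin using (Fin; zero; suc; _≟_)
  open import Data.Fin.Properties using (suc-injective)
  open import Function using (_∘_)
  open import Function.Definitions using (Injective)
  open import Relation.Nullary using (¬_; yes; no; contradiction)
  open import Relation.Binary.PropositionalEquality
  open import Algebra.Properties.Semiring.Sum ℤP.+-*-semiring
    using (sum; sum-cong-≗; ∑-distrib-+; ∑-comm; *-distribˡ-sum; *-distribʳ-sum)

  sumFin≡sum : ∀ {n} (f : Fin n → ℤ) → sumFin f ≡ sum f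
  sumFin≡sum {zero}  f = refl
  sumFin≡sum {suc n} f = cong (f zero +_) (sumFin≡sum (λ i → f (suc i)))

  sumFin-cong : ∀ {n} {f g : Fin n → ℤ} → f ≗ g → sumFin f ≡ sumFin g
  sumFin-cong {f = f} {g} f≗g
    rewrite sumFin≡sum f | sumFin≡sum g = sum-cong-≗ f≗g

  sumFin-+ : ∀ {n} (f g : Fin n → ℤ) → sumFin (λ i → f i + g i) ≡ sumFin f + sumFin g
  sumFin-+ f g
    rewrite sumFin≡sum (λ i → f i + g i) | sumFin≡sum f | sumFin≡sum g = ∑-distrib-+ f g

  sumFin-*ˡ : ∀ {n} (a : ℤ) (f : Fin n → ℤ) → sumFin (λ i → a * f i) ≡ a * sumFin f
  sumFin-*ˡ a f
    rewrite sumFin≡sum (λ i → a * f i) | sumFin≡sum f = sym (*-distribˡ-sum a f)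

  sumFin-*ʳ : ∀ {n} (a : ℤ) (f : Fin n → ℤ) → sumFin (λ i → f i * a) ≡ sumFin f * a
  sumFin-*ʳ a f
    rewrite sumFin≡sum (λ i → f i * a) | sumFin≡sum f = sym (*-distribʳ-sum a f)

  sumFin-comm : ∀ {m n} (F : Fin m → Fin n → ℤ) →
    sumFin (λ i → sumFin (F i)) ≡ sumFin (λ j → sumFin (λ i → F i j))
  sumFin-comm F = begin
    sumFin (λ i → sumFin (F i))             ≡⟨ sumFin-cong (λ i → sumFin≡sum (F i)) ⟩
    sumFin (λ i → sum (F i))                ≡⟨ sumFin≡sum (λ i → sum (F i)) ⟩
    sum (λ i → sum (F i))                   ≡⟨ ∑-comm F ⟩
    sum (λ j → sum (λ i → F i j))           ≡⟨ sym (sumFin≡sum (λ j → sum (λ i → F i j))) ⟩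
    sumFin (λ j → sum (λ i → F i j))        ≡⟨ sumFin-cong (λ j → sym (sumFin≡sum (λ i → F i j))) ⟩
    sumFin (λ j → sumFin (λ i → F i j))     ∎
    where open ≡-Reasoning

  sumFin-0 : ∀ {n} (f : Fin n → ℤ) → (∀ i → f i ≡ 0ℤ) → sumFin f ≡ 0ℤ
  sumFin-0 {zero}  f f≡0 = refl
  sumFin-0 {suc n} f f≡0 = cong₂ _+_ (f≡0 zero) (sumFin-0 (λ i → f (suc i)) (λ i → f≡0 (suc i)))

  sumFin-neg : ∀ {n} (f : Fin n → ℤ) → sumFin (λ i → - f i) ≡ - sumFin f
  sumFin-neg {zero}  f = refl
  sumFin-neg {suc n} f =
    trans (cong (- f zero +_) (sumFin-neg (λ i → f (suc i)))) (sym (ℤP.neg-distrib-+ (f zero) _))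

  δ-≡ : ∀ {n} {a b : Fin n} → a ≡ b → δ a b ≡ 1ℤ
  δ-≡ {a = a} {b} a≡b with a ≟ b
  ... | yes _  = refl
  ... | no a≢b = contradiction a≡b a≢b

  δ-≢ : ∀ {n} {a b : Fin n} → ¬ a ≡ b → δ a b ≡ 0ℤ
  δ-≢ {a = a} {b} a≢b with a ≟ b
  ... | yes a≡b = contradiction a≡b a≢b
  ... | no _    = refl

  δ-refl : ∀ {n} (a : Fin n) → δ a a ≡ 1ℤ
  δ-refl a = δ-≡ refl

  δ-sym : ∀ {n} (a b : Fin n) → δ a b ≡ δ b a
  δ-sym a b with a ≟ b
  ... | yes a≡b = sym (δ-≡ (sym a≡b))
  ... | no a≢b  = sym (δ-≢ (a≢b ∘ sym))

  δ-zero-suc : ∀ {n} (b : Fin n) → δ zero (suc b) ≡ 0ℤ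
  δ-zero-suc b = δ-≢ {a = zero} {suc b} λ ()

  δ-suc-zero : ∀ {n} (a : Fin n) → δ (suc a) zero ≡ 0ℤ
  δ-suc-zero a = δ-≢ {a = suc a} {zero} λ ()

  δ-injective : ∀ {m n} (f : Fin m → Fin n) → Injective _≡_ _≡_ f → ∀ a b → δ (f a) (f b) ≡ δ a b
  δ-injective f f-inj a b with a ≟ b
  ... | yes a≡b = δ-≡ (cong f a≡b)
  ... | no a≢b  = δ-≢ (a≢b ∘ f-inj)

  δ-suc : ∀ {n} (a b : Fin n) → δ (suc a) (suc b) ≡ δ a b
  δ-suc = δ-injective suc suc-injective

  sumFin-δˡ : ∀ {n} (c : Fin n) (f : Fin n → ℤ) → sumFin (λ j → δ c j * f j) ≡ f c
  sumFin-δˡ {suc n} zero f = begin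
    δ (zero {n}) zero * f zero + sumFin (λ j → δ zero (suc j) * f (suc j))
      ≡⟨ cong₂ _+_ (cong (_* f zero) (δ-refl (zero {n})))
                   (sumFin-0 _ (λ j → cong (_* f (suc j)) (δ-zero-suc j))) ⟩
    1ℤ * f zero + 0ℤ
      ≡⟨ trans (ℤP.+-identityʳ _) (ℤP.*-identityˡ (f zero)) ⟩
    f zero ∎
    where open ≡-Reasoning
  sumFin-δˡ (suc c) f = begin
    δ (suc c) zero * f zero + sumFin (λ j → δ (suc c) (suc j) * f (suc j))
      ≡⟨ cong₂ _+_ (cong (_* f zero) (δ-suc-zero c))
                   (sumFin-cong (λ j → cong (_* f (suc j)) (δ-suc c j))) ⟩
    0ℤ + sumFin (λ j → δ c j * f (suc j))
      ≡⟨ ℤP.+-identityˡ _ ⟩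
    sumFin (λ j → δ c j * f (suc j))
      ≡⟨ sumFin-δˡ c (λ j → f (suc j)) ⟩
    f (suc c) ∎
    where open ≡-Reasoning

  sumFin-δʳ : ∀ {n} (c : Fin n) (f : Fin n → ℤ) → sumFin (λ j → f j * δ j c) ≡ f c
  sumFin-δʳ c f =
    trans (sumFin-cong (λ j → trans (ℤP.*-comm (f j) _) (cong (_* f j) (δ-sym j c)))) (sumFin-δˡ c f)

module Counting where
  open import Data.Nat using (ℕ; zero; suc; _+_; _≤_; _<_; z≤n; s≤s)
  import Data.Nat.Properties as ℕP
  open import Data.Fin using (Fin; zero; suc)
  open import Data.Vec.Functional using (updateAt)
  open import Data.Bool using (Bool; true; false; _∧_; _∨_; not; if_then_else_)
  open import Data.Bool.Properties using (∧-conicalˡ; ∧-conicalʳ; ∨-conicalˡ; ∨-conicalʳ)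
  open import Data.Sum using (_⊎_; inj₁; inj₂)
  open import Data.Product using (∃; _×_; _,_; proj₁; proj₂)
  open import Function using (_∘_; const)
  open import Relation.Binary.PropositionalEquality

  ind : Bool → ℕ
  ind b = if b then 1 else 0

  ∧-true : ∀ {a b} → a ∧ b ≡ true → a ≡ true × b ≡ true
  ∧-true e = ∧-conicalˡ _ _ e , ∧-conicalʳ _ _ e

  ∨-true : ∀ {a b} → a ∨ b ≡ true → a ≡ true ⊎ b ≡ true
  ∨-true {true}  _ = inj₁ refl
  ∨-true {false} e = inj₂ e

  ∨-false : ∀ {a b} → a ∨ b ≡ false → a ≡ false × b ≡ false
  ∨-false e = ∨-conicalˡ _ _ e , ∨-conicalʳ _ _ e

  not-true : ∀ {a} → not a ≡ true → a ≡ false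
  not-true {false} _ = refl

  allB-true : ∀ {n} (f : Fin n → Bool) → allB f ≡ true → ∀ i → f i ≡ true
  allB-true f e zero    = proj₁ (∧-true e)
  allB-true f e (suc i) = allB-true (f ∘ suc) (proj₂ (∧-true {f zero} e)) i

  allB-intro : ∀ {n} (f : Fin n → Bool) → (∀ i → f i ≡ true) → allB f ≡ true
  allB-intro {zero}  f _ = refl
  allB-intro {suc n} f t rewrite t zero = allB-intro (f ∘ suc) (t ∘ suc)

  count-cong : ∀ {n} {f g : Fin n → Bool} → f ≗ g → count f ≡ count g
  count-cong {zero}  _   = refl
  count-cong {suc n} f≗g = cong₂ (λ b k → ind b + k) (f≗g zero) (count-cong (f≗g ∘ suc))

  count≡0⇒false : ∀ {n} (f : Fin n → Bool) → count f ≡ 0 → ∀ i → f i ≡ false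
  count≡0⇒false f c≡0 zero    with f zero
  ... | false = refl
  count≡0⇒false f c≡0 (suc i) with f zero
  ... | false = count≡0⇒false (f ∘ suc) c≡0 i

  count-nonempty : ∀ {n} (f : Fin n → Bool) → 0 < count f → ∃ λ i → f i ≡ true
  count-nonempty {suc n} f pos with f zero in e
  ... | true  = zero , e
  ... | false = let i , fi = count-nonempty (f ∘ suc) pos in suc i , fi

  count-remove : ∀ {n} (f : Fin n → Bool) r → f r ≡ true →
                 suc (count (updateAt f r (const false))) ≡ count f
  count-remove f zero    fr rewrite fr = refl
  count-remove f (suc r) fr =
    trans (sym (ℕP.+-suc (ind (f zero)) _)) (cong (ind (f zero) +_) (count-remove (f ∘ suc) r fr))

  count-mono : ∀ {n} (f g : Fin n → Bool) → (∀ i → f i ≡ true → g i ≡ true) → count f ≤ count g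
  count-mono {zero}  f g _   = z≤n
  count-mono {suc n} f g f⊆g with f zero in ef | g zero in eg
  ... | true  | true  = s≤s (count-mono (f ∘ suc) (g ∘ suc) (f⊆g ∘ suc))
  ... | true  | false with () ← trans (sym (f⊆g zero ef)) eg
  ... | false | true  = ℕP.m≤n⇒m≤1+n (count-mono (f ∘ suc) (g ∘ suc) (f⊆g ∘ suc))
  ... | false | false = count-mono (f ∘ suc) (g ∘ suc) (f⊆g ∘ suc)

  count-∨-∧ : ∀ {n} (f g : Fin n → Bool) →
              count (λ i → f i ∨ g i) + count (λ i → f i ∧ g i) ≡ count f + count g
  count-∨-∧ {zero}  f g = refl
  count-∨-∧ {suc n} f g with f zero | g zero | count-∨-∧ (f ∘ suc) (g ∘ suc)
  ... | true  | true  | ih = cong suc (trans (ℕP.+-suc _ _) (trans (cong suc ih) (sym (ℕP.+-suc _ _))))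
  ... | true  | false | ih = cong suc ih
  ... | false | true  | ih = trans (cong suc ih) (sym (ℕP.+-suc _ _))
  ... | false | false | ih = ih

  count-split : ∀ {n} (f g : Fin n → Bool) →
                count f ≡ count (λ i → f i ∧ g i) + count (λ i → f i ∧ not (g i))
  count-split {zero}  f g = refl
  count-split {suc n} f g with f zero | g zero | count-split (f ∘ suc) (g ∘ suc)
  ... | true  | true  | ih = cong suc ih
  ... | true  | false | ih = trans (cong suc ih) (sym (ℕP.+-suc _ _))
  ... | false | _     | ih = ih

  count-<⇒difference : ∀ {n} (f g : Fin n → Bool) → count f < count g →
                       ∃ λ i → g i ≡ true × f i ≡ false
  count-<⇒difference f g lt with count-nonempty (λ i → g i ∧ not (f i)) pos
    where
    pos : 0 < count (λ i → g i ∧ not (f i))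
    pos = ℕP.n≢0⇒n>0 λ c≡0 → ℕP.<⇒≱ lt (begin
      count g                                                     ≡⟨ count-split g f ⟩
      count (λ i → g i ∧ f i) + count (λ i → g i ∧ not (f i))     ≡⟨ cong (count (λ i → g i ∧ f i) +_) c≡0 ⟩
      count (λ i → g i ∧ f i) + 0                                 ≡⟨ ℕP.+-identityʳ _ ⟩
      count (λ i → g i ∧ f i)                                     ≤⟨ count-mono _ f (λ i → proj₂ ∘ ∧-true) ⟩
      count f                                                     ∎)
      where open ℕP.≤-Reasoning
  ... | i , e = i , proj₁ (∧-true e) , not-true (proj₂ (∧-true e))

  pigeonhole : ∀ {n} (f g U : Fin n → Bool) → (∀ i → f i ∨ g i ≡ true → U i ≡ true) →
                  count U < count f + count g → ∃ λ i → f i ≡ true × g i ≡ true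
  pigeonhole f g U f∪g⊆U lt with count-nonempty (λ i → f i ∧ g i) pos
    where
    pos : 0 < count (λ i → f i ∧ g i)
    pos = ℕP.n≢0⇒n>0 λ c≡0 → ℕP.<⇒≱ lt (begin
      count f + count g                                        ≡⟨ sym (count-∨-∧ f g) ⟩
      count (λ i → f i ∨ g i) + count (λ i → f i ∧ g i)        ≡⟨ cong (count (λ i → f i ∨ g i) +_) c≡0 ⟩
      count (λ i → f i ∨ g i) + 0                              ≡⟨ ℕP.+-identityʳ _ ⟩
      count (λ i → f i ∨ g i)                                  ≤⟨ count-mono _ U f∪g⊆U ⟩
      count U                                                  ∎)
      where open ℕP.≤-Reasoning
  ... | i , e = i , ∧-true e

module Determinant where
  open import Data.Nat using (ℕ; zero; suc)
  open import Data.Integer using (ℤ; -_; _+_; _*_; 0ℤ; 1ℤ; +0)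
  import Data.Integer.Properties as ℤP
  open import Data.Fin using (Fin; zero; suc; punchIn; _≟_)
  open import Data.Fin.Properties using (punchIn-injective; punchInᵢ≢i; suc-injective)
  open import Data.Vec.Functional using (updateAt)
  open import Data.Vec.Functional.Properties using (updateAt-updates; updateAt-minimal)
  open import Data.Bool using (if_then_else_)
  open import Data.Product using (∃₂; _×_; _,_)
  open import Function using (_∘_; const)
  open import Relation.Nullary using (¬_; yes; no; does; contradiction)
  open import Relation.Nullary.Decidable using (dec-true; dec-false)
  open import Relation.Binary.PropositionalEquality
  open import Data.Integer.Tactic.RingSolver
  open import Algebra.Properties.AbelianGroup ℤP.+-0-abelianGroup using (inverseʳ-unique)
  open Sums

  Mat : ℕ → Set
  Mat n = Fin n → Fin n → ℤ

  I : ∀ {n} → Mat n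
  I = δ

  _*ᴹ_ : ∀ {n} → Mat n → Mat n → Mat n
  (X *ᴹ Y) r c = sumFin (λ k → X r k * Y k c)

  minor : ∀ {n} → Mat (suc n) → Fin (suc n) → Mat n
  minor X j r c = X (suc r) (punchIn j c)

  sign : ∀ {n} → Fin n → ℤ
  sign j = sgn (toℕ' j)

  RowsAgreeOff : ∀ {n} → Fin n → Mat n → Mat n → Set
  RowsAgreeOff r X Y = ∀ r′ → ¬ r′ ≡ r → X r′ ≗ Y r′

  record IsMultilinear {n} (g : Mat n → ℤ) : Set where
    field
      extensional : ∀ X Y → (∀ r → X r ≗ Y r) → g X ≡ g Y
      additive    : ∀ r X Y Z → RowsAgreeOff r X Z → RowsAgreeOff r Y Z →
                    (∀ c → Z r c ≡ X r c + Y r c) → g Z ≡ g X + g Y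
      homogeneous : ∀ r a X Z → RowsAgreeOff r X Z → (∀ c → Z r c ≡ a * X r c) → g Z ≡ a * g X

  record IsAlternatingMultilinear {n} (g : Mat n → ℤ) : Set where
    field
      multilinear : IsMultilinear g
      alternating : ∀ X r r′ → ¬ r ≡ r′ → X r ≗ X r′ → g X ≡ 0ℤ
    open IsMultilinear multilinear public

  updateRow : ∀ {n} → Mat n → Fin n → (Fin n → ℤ) → Mat n
  updateRow X p u = updateAt X p (const u)

  updateRow-updates : ∀ {n} (X : Mat n) p u → updateRow X p u p ≗ u
  updateRow-updates X p u = cong-app (updateAt-updates p X)

  updateRow-minimal : ∀ {n} (X : Mat n) p u r → ¬ r ≡ p → updateRow X p u r ≗ X r
  updateRow-minimal X p u r r≢p = cong-app (updateAt-minimal r p X r≢p)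

  updateRow-agreeOff : ∀ {n} (X : Mat n) p u v → RowsAgreeOff p (updateRow X p u) (updateRow X p v)
  updateRow-agreeOff X p u v r r≢p c =
    trans (updateRow-minimal X p u r r≢p c) (sym (updateRow-minimal X p v r r≢p c))

  det-cong : ∀ {n} (X Y : Mat n) → (∀ r → X r ≗ Y r) → det X ≡ det Y
  det-cong {zero}  X Y X≗Y = refl
  det-cong {suc n} X Y X≗Y = sumFin-cong λ j →
    cong₂ (λ a b → sign j * (a * b)) (X≗Y zero j)
          (det-cong (minor X j) (minor Y j) (λ r c → X≗Y (suc r) (punchIn j c)))

  minor-agreeOff : ∀ {n} r (X Z : Mat (suc n)) j → RowsAgreeOff (suc r) X Z → RowsAgreeOff r (minor X j) (minor Z j)
  minor-agreeOff r X Z j X≈Z r′ r′≢r c = X≈Z (suc r′) (r′≢r ∘ suc-injective) (punchIn j c)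

  minor-agreeOff-zero : ∀ {n} (X Z : Mat (suc n)) j → RowsAgreeOff zero X Z → ∀ r → minor X j r ≗ minor Z j r
  minor-agreeOff-zero X Z j X≈Z r c = X≈Z (suc r) (λ ()) (punchIn j c)

  det-additive : ∀ {n} r (X Y Z : Mat n) → RowsAgreeOff r X Z → RowsAgreeOff r Y Z →
                 (∀ c → Z r c ≡ X r c + Y r c) → det Z ≡ det X + det Y
  det-additive {suc n} zero X Y Z X≈Z Y≈Z Zr =
    trans (sumFin-cong term) (sumFin-+ (λ j → sign j * (X zero j * det (minor X j)))
                                       (λ j → sign j * (Y zero j * det (minor Y j))))
    where
    distrib : ∀ a b c d → a * ((b + c) * d) ≡ a * (b * d) + a * (c * d)
    distrib = solve-∀
    term : ∀ j → sign j * (Z zero j * det (minor Z j))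
               ≡ sign j * (X zero j * det (minor X j)) + sign j * (Y zero j * det (minor Y j))
    term j rewrite Zr j
                 | det-cong (minor Z j) (minor X j) (λ r c → sym (minor-agreeOff-zero X Z j X≈Z r c))
                 | det-cong (minor X j) (minor Y j) (λ r c →
                     trans (minor-agreeOff-zero X Z j X≈Z r c) (sym (minor-agreeOff-zero Y Z j Y≈Z r c)))
                 = distrib (sign j) (X zero j) (Y zero j) (det (minor Y j))
  det-additive {suc n} (suc r) X Y Z X≈Z Y≈Z Zr =
    trans (sumFin-cong term) (sumFin-+ (λ j → sign j * (X zero j * det (minor X j)))
                                       (λ j → sign j * (Y zero j * det (minor Y j))))
    where
    distrib : ∀ a b c d → a * (b * (c + d)) ≡ a * (b * c) + a * (b * d)
    distrib = solve-∀
    term : ∀ j → sign j * (Z zero j * det (minor Z j))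
               ≡ sign j * (X zero j * det (minor X j)) + sign j * (Y zero j * det (minor Y j))
    term j rewrite det-additive r (minor X j) (minor Y j) (minor Z j)
                     (minor-agreeOff r X Z j X≈Z) (minor-agreeOff r Y Z j Y≈Z) (Zr ∘ punchIn j)
                 | sym (X≈Z zero (λ ()) j) | trans (Y≈Z zero (λ ()) j) (sym (X≈Z zero (λ ()) j))
                 = distrib (sign j) (X zero j) (det (minor X j)) (det (minor Y j))

  det-homogeneous : ∀ {n} r a (X Z : Mat n) → RowsAgreeOff r X Z → (∀ c → Z r c ≡ a * X r c) →
                    det Z ≡ a * det X
  det-homogeneous {suc n} zero a X Z X≈Z Zr =
    trans (sumFin-cong term) (sumFin-*ˡ a (λ j → sign j * (X zero j * det (minor X j))))
    where
    reorder : ∀ a b c d → b * ((a * c) * d) ≡ a * (b * (c * d))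
    reorder = solve-∀
    term : ∀ j → sign j * (Z zero j * det (minor Z j)) ≡ a * (sign j * (X zero j * det (minor X j)))
    term j rewrite Zr j | det-cong (minor Z j) (minor X j) (λ r c → sym (minor-agreeOff-zero X Z j X≈Z r c))
      = reorder a (sign j) (X zero j) (det (minor X j))
  det-homogeneous {suc n} (suc r) a X Z X≈Z Zr =
    trans (sumFin-cong term) (sumFin-*ˡ a (λ j → sign j * (X zero j * det (minor X j))))
    where
    reorder : ∀ a b c d → b * (c * (a * d)) ≡ a * (b * (c * d))
    reorder = solve-∀
    term : ∀ j → sign j * (Z zero j * det (minor Z j)) ≡ a * (sign j * (X zero j * det (minor X j)))
    term j rewrite det-homogeneous r a (minor X j) (minor Z j) (minor-agreeOff r X Z j X≈Z) (Zr ∘ punchIn j)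
                 | sym (X≈Z zero (λ ()) j)
      = reorder a (sign j) (X zero j) (det (minor X j))

  det-multilinear : ∀ {n} → IsMultilinear (det {n})
  det-multilinear = record
    { extensional = det-cong
    ; additive    = det-additive
    ; homogeneous = det-homogeneous
    }

  module _ {n} {g : Mat n → ℤ} (g-ml : IsMultilinear g) where
    open IsMultilinear g-ml

    additive-sumFin : ∀ r (X : Mat n) {m} (F : Fin m → Fin n → ℤ) →
                      g (updateRow X r (λ c → sumFin (λ k → F k c))) ≡ sumFin (λ k → g (updateRow X r (F k)))
    additive-sumFin r X {zero} F =
      homogeneous r 0ℤ X (updateRow X r (const 0ℤ))
        (λ r′ r′≢r c → sym (updateRow-minimal X r _ r′ r′≢r c)) (updateRow-updates X r _)
    additive-sumFin r X {suc m} F =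
      trans (additive r (updateRow X r (F zero)) (updateRow X r (λ c → sumFin (λ k → F (suc k) c))) _
               (updateRow-agreeOff X r _ _) (updateRow-agreeOff X r _ _)
               (λ c → trans (updateRow-updates X r _ c)
                            (sym (cong₂ _+_ (updateRow-updates X r _ c) (updateRow-updates X r _ c)))))
            (cong (_+_ (g (updateRow X r (F zero)))) (additive-sumFin r X (F ∘ suc)))

    expand-row : ∀ r (Z : Mat n) (M : Fin n → Mat n) →
                 (∀ k → RowsAgreeOff r (M k) Z) → (∀ k → M k r ≗ δ k) →
                 g Z ≡ sumFin (λ k → Z r k * g (M k))
    expand-row r Z M M≈Z Mr = begin
      g Z                                                           ≡⟨ extensional Z Z′ Z≗Z′ ⟩
      g Z′                                                          ≡⟨ additive-sumFin r Z (λ k c → Z r k * δ k c) ⟩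
      sumFin (λ k → g (updateRow Z r (λ c → Z r k * δ k c)))        ≡⟨ sumFin-cong scale ⟩
      sumFin (λ k → Z r k * g (M k))                                ∎
      where
      open ≡-Reasoning
      Z′ : Mat n
      Z′ = updateRow Z r (λ c → sumFin (λ k → Z r k * δ k c))
      Z≗Z′ : ∀ r′ → Z r′ ≗ Z′ r′
      Z≗Z′ r′ c with r′ ≟ r
      ... | yes refl = sym (trans (updateRow-updates Z r _ c) (sumFin-δʳ c (Z r)))
      ... | no r′≢r  = sym (updateRow-minimal Z r _ r′ r′≢r c)
      scale : ∀ k → g (updateRow Z r (λ c → Z r k * δ k c)) ≡ Z r k * g (M k)
      scale k = homogeneous r (Z r k) (M k) _
        (λ r′ r′≢r c → trans (M≈Z k r′ r′≢r c) (sym (updateRow-minimal Z r _ r′ r′≢r c)))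
        (λ c → trans (updateRow-updates Z r _ c) (cong (Z r k *_) (sym (Mr k c))))

  module _ {n} {g : Mat n → ℤ} (g-aml : IsAlternatingMultilinear g) where
    open IsAlternatingMultilinear g-aml

    -- With W a b the matrix having rows a at p and b at q, W is bilinear and W a a ↦ 0, so
    -- 0 = g (W (a + b) (a + b)) = g (W a b) + g (W b a).
    antisymmetric : ∀ X Y (p q : Fin n) → ¬ p ≡ q → Y p ≗ X q → Y q ≗ X p →
                    (∀ r → ¬ r ≡ p → ¬ r ≡ q → Y r ≗ X r) → g Y ≡ - g X
    antisymmetric X Y p q p≢q Yp Yq Yr = inverseʳ-unique (g X) (g Y) (sym zero≡gX+gY)
      where
      W : (Fin n → ℤ) → (Fin n → ℤ) → Mat n
      W a b = updateRow (updateRow X p a) q b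
      W-q : ∀ a b → W a b q ≗ b
      W-q a b = updateRow-updates (updateRow X p a) q b
      W-p : ∀ a b → W a b p ≗ a
      W-p a b c = trans (updateRow-minimal (updateRow X p a) q b p p≢q c) (updateRow-updates X p a c)
      W-rest : ∀ a b r → ¬ r ≡ p → ¬ r ≡ q → W a b r ≗ X r
      W-rest a b r r≢p r≢q c =
        trans (updateRow-minimal (updateRow X p a) q b r r≢q c) (updateRow-minimal X p a r r≢p c)
      W-offp : ∀ a a′ b → RowsAgreeOff p (W a b) (W a′ b)
      W-offp a a′ b r r≢p c with r ≟ q
      ... | yes refl = trans (W-q a b c) (sym (W-q a′ b c))
      ... | no r≢q   = trans (W-rest a b r r≢p r≢q c) (sym (W-rest a′ b r r≢p r≢q c))
      W-offq : ∀ a b b′ → RowsAgreeOff q (W a b) (W a b′)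
      W-offq a b b′ r r≢q c with r ≟ p
      ... | yes refl = trans (W-p a b c) (sym (W-p a b′ c))
      ... | no r≢p   = trans (W-rest a b r r≢p r≢q c) (sym (W-rest a b′ r r≢p r≢q c))
      W-diag : ∀ a → g (W a a) ≡ 0ℤ
      W-diag a = alternating (W a a) p q p≢q (λ c → trans (W-p a a c) (sym (W-q a a c)))
      W-match : ∀ a b (Z : Mat n) → Z p ≗ a → Z q ≗ b → (∀ r → ¬ r ≡ p → ¬ r ≡ q → Z r ≗ X r) →
                g (W a b) ≡ g Z
      W-match a b Z Zp Zq Zr = extensional (W a b) Z rows
        where
        rows : ∀ r → W a b r ≗ Z r
        rows r c with r ≟ p | r ≟ q
        ... | yes refl | _        = trans (W-p a b c) (sym (Zp c))
        ... | no _     | yes refl = trans (W-q a b c) (sym (Zq c))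
        ... | no r≢p   | no r≢q   = trans (W-rest a b r r≢p r≢q c) (sym (Zr r r≢p r≢q c))
      xp xq s : Fin n → ℤ
      xp = X p
      xq = X q
      s c = xp c + xq c
      split-p : g (W s s) ≡ g (W xp s) + g (W xq s)
      split-p = additive p (W xp s) (W xq s) (W s s) (W-offp xp s s) (W-offp xq s s)
                  (λ c → trans (W-p s s c) (sym (cong₂ _+_ (W-p xp s c) (W-p xq s c))))
      split-q : ∀ a → g (W a s) ≡ g (W a xp) + g (W a xq)
      split-q a = additive q (W a xp) (W a xq) (W a s) (W-offq a xp s) (W-offq a xq s)
                    (λ c → trans (W-q a s c) (sym (cong₂ _+_ (W-q a xp c) (W-q a xq c))))
      zero≡gX+gY : 0ℤ ≡ g X + g Y
      zero≡gX+gY = begin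
        0ℤ                                                        ≡⟨ sym (W-diag s) ⟩
        g (W s s)                                                 ≡⟨ split-p ⟩
        g (W xp s) + g (W xq s)                                   ≡⟨ cong₂ _+_ (split-q xp) (split-q xq) ⟩
        (g (W xp xp) + g (W xp xq)) + (g (W xq xp) + g (W xq xq)) ≡⟨ cong₂ _+_
            (cong₂ _+_ (W-diag xp) (W-match xp xq X (λ _ → refl) (λ _ → refl) (λ _ _ _ _ → refl)))
            (cong₂ _+_ (W-match xq xp Y Yp Yq Yr)
                       (W-diag xq)) ⟩
        (0ℤ + g X) + (g Y + 0ℤ)                                   ≡⟨ cong₂ _+_ (ℤP.+-identityˡ (g X)) (ℤP.+-identityʳ (g Y)) ⟩
        g X + g Y                                                 ∎
        where open ≡-Reasoning


  quadratic-antisymmetric≡0 : ∀ {m} (b : Fin m → ℤ) (U : Fin m → Fin m → ℤ) → (∀ j k → U j k ≡ - U k j) →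
                              sumFin (λ j → b j * sumFin (λ k → b k * U j k)) ≡ 0ℤ
  quadratic-antisymmetric≡0 b U U-anti = x≡-x⇒x≡0 S S≡-S
    where
    x≡-x⇒x≡0 : ∀ x → x ≡ - x → x ≡ 0ℤ
    x≡-x⇒x≡0 +0 _ = refl
    S = sumFin (λ j → b j * sumFin (λ k → b k * U j k))
    F : Fin _ → Fin _ → ℤ
    F j k = b j * (b k * U j k)
    flip-sign : ∀ x y z → x * (y * (- z)) ≡ - (y * (x * z))
    flip-sign = solve-∀
    S≡-S : S ≡ - S
    S≡-S = begin
      S                                       ≡⟨ sumFin-cong (λ j → sym (sumFin-*ˡ (b j) (λ k → b k * U j k))) ⟩
      sumFin (λ j → sumFin (F j))             ≡⟨ sumFin-comm F ⟩
      sumFin (λ k → sumFin (λ j → F j k))     ≡⟨ sumFin-cong (λ k → sumFin-cong (λ j →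
                                                   trans (cong (λ z → b j * (b k * z)) (U-anti j k))
                                                         (flip-sign (b j) (b k) (U k j)))) ⟩
      sumFin (λ k → sumFin (λ j → - F k j))   ≡⟨ sumFin-cong (λ k → sumFin-neg (F k)) ⟩
      sumFin (λ k → - sumFin (F k))           ≡⟨ sumFin-neg (λ k → sumFin (F k)) ⟩
      - sumFin (λ k → sumFin (F k))           ≡⟨ cong -_ (sumFin-cong (λ k → sumFin-*ˡ (b k) (λ j → b j * U k j))) ⟩
      - S                                     ∎
      where open ≡-Reasoning

  -- Removing two distinct columns j ≠ k in either order gives the same matrix, with opposite signs.
  punchIn-transpose : ∀ {n} (j k : Fin (suc (suc n))) → ¬ j ≡ k →
    ∃₂ λ (k′ j′ : Fin (suc n)) →
      punchIn j k′ ≡ k × punchIn k j′ ≡ j ×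
      (∀ c → punchIn j (punchIn k′ c) ≡ punchIn k (punchIn j′ c)) ×
      sign j * sign k′ ≡ - (sign k * sign j′)
  punchIn-transpose zero    zero    j≢k = contradiction refl j≢k
  punchIn-transpose zero    (suc k) _   = k , zero , refl , refl , (λ _ → refl) , lemma (sign k)
    where
    lemma : ∀ x → 1ℤ * x ≡ - ((- x) * 1ℤ)
    lemma = solve-∀
  punchIn-transpose (suc j) zero    _   = zero , j , refl , refl , (λ _ → refl) , lemma (sign j)
    where
    lemma : ∀ x → (- x) * 1ℤ ≡ - (1ℤ * x)
    lemma = solve-∀
  punchIn-transpose {zero}  (suc zero) (suc zero) j≢k = contradiction refl j≢k
  punchIn-transpose {suc n} (suc j) (suc k) j≢k
    with punchIn-transpose j k (j≢k ∘ cong suc)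
  ... | k′ , j′ , pj , pk , commute , signs = suc k′ , suc j′ , cong suc pj , cong suc pk , commute′ , signs′
    where
    commute′ : ∀ c → punchIn (suc j) (punchIn (suc k′) c) ≡ punchIn (suc k) (punchIn (suc j′) c)
    commute′ zero    = refl
    commute′ (suc c) = cong suc (commute c)
    negate₂ : ∀ a b → (- a) * (- b) ≡ a * b
    negate₂ = solve-∀
    signs′ : (- sign j) * (- sign k′) ≡ - ((- sign k) * (- sign j′))
    signs′ = trans (negate₂ (sign j) (sign k′)) (trans signs (cong -_ (sym (negate₂ (sign k) (sign j′)))))

  det-unitRow : ∀ {n} (X : Mat (suc n)) j → X zero ≗ δ j → det X ≡ sign j * det (minor X j)
  det-unitRow X j X0 =
    trans (sumFin-cong (λ j′ → trans (cong (λ a → sign j′ * (a * det (minor X j′))) (X0 j′))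
                                     (swap (sign j′) (δ j j′) (det (minor X j′)))))
          (sumFin-δˡ j (λ j′ → sign j′ * det (minor X j′)))
    where
    swap : ∀ a b c → a * (b * c) ≡ b * (a * c)
    swap = solve-∀

  det-zeroRow : ∀ {n} (X : Mat (suc n)) → X zero ≗ const 0ℤ → det X ≡ 0ℤ
  det-zeroRow X X0 = sumFin-0 _ (λ j →
    trans (cong (λ a → sign j * (a * det (minor X j))) (X0 j)) (ℤP.*-zeroʳ (sign j)))

  -- Expanding the first two rows, det X = Σⱼ Σₖ aⱼ aₖ T j k with T j k = det (eⱼ; eₖ; rest) antisymmetric.
  det-equalLeadingRows : ∀ {n} (X : Mat (suc (suc n))) → X zero ≗ X (suc zero) → det X ≡ 0ℤ
  det-equalLeadingRows {n} X X0≗X1 = begin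
    det X                                                    ≡⟨ expand-row det-multilinear zero X (λ j → R (δ j) a) rest₀ (λ _ _ → refl) ⟩
    sumFin (λ j → a j * det (R (δ j) a))                     ≡⟨ sumFin-cong (λ j → cong (a j *_) (expand-row det-multilinear (suc zero) (R (δ j) a) (λ k → R (δ j) (δ k)) (rest₁ j) (λ _ _ → refl))) ⟩
    sumFin (λ j → a j * sumFin (λ k → a k * T j k))          ≡⟨ quadratic-antisymmetric≡0 a T T-anti ⟩
    0ℤ                                                       ∎
    where
    open ≡-Reasoning
    a : Fin (suc (suc n)) → ℤ
    a = X zero
    R : (Fin (suc (suc n)) → ℤ) → (Fin (suc (suc n)) → ℤ) → Mat (suc (suc n))
    R u v zero          = u
    R u v (suc zero)    = v
    R u v (suc (suc r)) = X (suc (suc r))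
    rest₀ : ∀ j → RowsAgreeOff zero (R (δ j) a) X
    rest₀ j zero          0≢0 = contradiction refl 0≢0
    rest₀ j (suc zero)    _   = X0≗X1
    rest₀ j (suc (suc r)) _ _ = refl
    rest₁ : ∀ j k → RowsAgreeOff (suc zero) (R (δ j) (δ k)) (R (δ j) a)
    rest₁ j k zero          _   _ = refl
    rest₁ j k (suc zero)    1≢1 = contradiction refl 1≢1
    rest₁ j k (suc (suc r)) _   _ = refl
    T : Fin (suc (suc n)) → Fin (suc (suc n)) → ℤ
    T j k = det (R (δ j) (δ k))
    W : Fin (suc (suc n)) → Fin (suc n) → Mat n
    W j k′ r c = X (suc (suc r)) (punchIn j (punchIn k′ c))
    T-value : ∀ j k k′ → punchIn j k′ ≡ k → T j k ≡ sign j * (sign k′ * det (W j k′))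
    T-value j k k′ refl = trans (det-unitRow (R (δ j) (δ k)) j (λ _ → refl))
      (cong (sign j *_) (det-unitRow (minor (R (δ j) (δ k)) j) k′
         (δ-injective (punchIn j) (punchIn-injective j _ _) k′)))
    T-diag : ∀ j → T j j ≡ 0ℤ
    T-diag j = trans (det-unitRow (R (δ j) (δ j)) j (λ _ → refl))
      (trans (cong (sign j *_) (det-zeroRow (minor (R (δ j) (δ j)) j) (λ c → δ-≢ (punchInᵢ≢i j c ∘ sym))))
             (ℤP.*-zeroʳ (sign j)))
    T-anti : ∀ j k → T j k ≡ - T k j
    T-anti j k with j ≟ k
    ... | yes refl = trans (T-diag j) (cong -_ (sym (T-diag j)))
    ... | no j≢k with punchIn-transpose j k j≢k
    ... | k′ , j′ , pj , pk , commute , signs = begin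
      T j k                                    ≡⟨ T-value j k k′ pj ⟩
      sign j * (sign k′ * det (W j k′))        ≡⟨ cong (λ z → sign j * (sign k′ * z))
                                                       (det-cong (W j k′) (W k j′) (λ r c → cong (X (suc (suc r))) (commute c))) ⟩
      sign j * (sign k′ * det (W k j′))        ≡⟨ regroup (sign j) (sign k′) (det (W k j′)) ⟩
      (sign j * sign k′) * det (W k j′)        ≡⟨ cong (_* det (W k j′)) signs ⟩
      - (sign k * sign j′) * det (W k j′)      ≡⟨ regroup-neg (sign k) (sign j′) (det (W k j′)) ⟩
      - (sign k * (sign j′ * det (W k j′)))    ≡⟨ cong -_ (sym (T-value k j j′ pk)) ⟩
      - T k j                                  ∎
      where
      regroup : ∀ a b c → a * (b * c) ≡ (a * b) * c
      regroup = solve-∀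
      regroup-neg : ∀ a b c → (- (a * b)) * c ≡ - (a * (b * c))
      regroup-neg = solve-∀

  det-repeatedFirstRow : ∀ {n} → IsAlternatingMultilinear (det {n}) →
                         ∀ (X : Mat (suc n)) r → X zero ≗ X (suc r) → det X ≡ 0ℤ
  det-repeatedFirstRow {suc n} _       X zero    X0≗X1 = det-equalLeadingRows X X0≗X1
  det-repeatedFirstRow {suc n} det-aml X (suc r) X0≗Xr = begin
    det X        ≡⟨ sym (ℤP.neg-involutive (det X)) ⟩
    - - det X    ≡⟨ cong -_ (sym detY≡-detX) ⟩
    - det Y      ≡⟨ cong -_ (det-equalLeadingRows Y X0≗Xr) ⟩
    0ℤ           ∎
    where
    open ≡-Reasoning
    Y : Mat (suc (suc n))
    Y zero          = X zero
    Y (suc zero)    = X (suc (suc r))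
    Y (suc (suc t)) = if does (t ≟ r) then X (suc zero) else X (suc (suc t))
    minors-swapped : ∀ j → det (minor Y j) ≡ - det (minor X j)
    minors-swapped j = antisymmetric det-aml (minor X j) (minor Y j) zero (suc r) (λ ())
      (λ _ → refl)
      (λ c → cong (λ b → (if b then X (suc zero) else X (suc (suc r))) (punchIn j c)) (dec-true (r ≟ r) refl))
      rest
      where
      rest : ∀ t → ¬ t ≡ zero → ¬ t ≡ suc r → minor Y j t ≗ minor X j t
      rest zero    t≢0 _    = contradiction refl t≢0
      rest (suc t) _   t≢sr c =
        cong (λ b → (if b then X (suc zero) else X (suc (suc t))) (punchIn j c)) (dec-false (t ≟ r) (t≢sr ∘ cong suc))
    negate : ∀ a b c → a * (b * (- c)) ≡ - (a * (b * c))
    negate = solve-∀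
    detY≡-detX : det Y ≡ - det X
    detY≡-detX =
      trans (sumFin-cong (λ j → trans (cong (λ z → sign j * (X zero j * z)) (minors-swapped j))
                                      (negate (sign j) (X zero j) (det (minor X j)))))
            (sumFin-neg (λ j → sign j * (X zero j * det (minor X j))))

  det-alternating : ∀ {n} (X : Mat n) r r′ → ¬ r ≡ r′ → X r ≗ X r′ → det X ≡ 0ℤ
  det-alternating {suc n} X zero    zero     0≢0 _ = contradiction refl 0≢0
  det-alternating {suc n} X zero    (suc r′) _   eq = det-repeatedFirstRow det-aml X r′ eq
    where det-aml = record { multilinear = det-multilinear ; alternating = det-alternating }
  det-alternating {suc n} X (suc r) zero     _   eq = det-repeatedFirstRow det-aml X r (sym ∘ eq)
    where det-aml = record { multilinear = det-multilinear ; alternating = det-alternating }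
  det-alternating {suc n} X (suc r) (suc r′) r≢r′ eq = sumFin-0 _ λ j →
    trans (cong (λ z → sign j * (X zero j * z))
                (det-alternating (minor X j) r r′ (r≢r′ ∘ cong suc) (eq ∘ punchIn j)))
          (vanish (sign j) (X zero j))
    where
    vanish : ∀ a b → a * (b * 0ℤ) ≡ 0ℤ
    vanish = solve-∀


module DeterminantProduct where
  open import Data.Nat using (zero; suc; _<_; z≤n; s≤s)
  import Data.Nat.Properties as ℕP
  open import Data.Integer using (ℤ; -_; _+_; _-_; _*_; _^_; 0ℤ; 1ℤ; ≢-nonZero)
  import Data.Integer.Properties as ℤP
  open import Data.Fin using (Fin; zero; suc; punchIn)
  open import Data.Fin.Properties using (suc-injective)
  open import Data.Vec.Functional using (updateAt; insertAt)
  open import Data.Vec.Functional.Properties using (updateAt-updates; updateAt-minimal; insertAt-punchIn)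
  open import Data.Bool using (Bool; true; false; if_then_else_)
  open import Data.Product using (_,_)
  open import Function using (_∘_; const)
  open import Relation.Nullary using (¬_; contradiction)
  open import Relation.Binary.PropositionalEquality
  open import Data.Integer.Tactic.RingSolver
  open Sums
  open Counting using (count-nonempty; count-remove; count≡0⇒false)
  open Determinant

  insertZero : ∀ {n} → Fin (suc n) → (Fin n → ℤ) → Fin (suc n) → ℤ
  insertZero k v = insertAt v k 0ℤ

  insertZero-cong : ∀ {n} (k : Fin (suc n)) {u v} → u ≗ v → insertZero k u ≗ insertZero k v
  insertZero-cong zero    u≗v zero    = refl
  insertZero-cong zero    u≗v (suc c) = u≗v c
  insertZero-cong {suc n} (suc k) u≗v zero    = u≗v zero
  insertZero-cong {suc n} (suc k) u≗v (suc c) = insertZero-cong k (u≗v ∘ suc) c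

  insertZero-+ : ∀ {n} (k : Fin (suc n)) {u v w} → (∀ c → w c ≡ u c + v c) →
                 ∀ c → insertZero k w c ≡ insertZero k u c + insertZero k v c
  insertZero-+ zero    w≡u+v zero    = refl
  insertZero-+ zero    w≡u+v (suc c) = w≡u+v c
  insertZero-+ {suc n} (suc k) w≡u+v zero    = w≡u+v zero
  insertZero-+ {suc n} (suc k) w≡u+v (suc c) = insertZero-+ k (w≡u+v ∘ suc) c

  insertZero-* : ∀ {n} (k : Fin (suc n)) a {u w} → (∀ c → w c ≡ a * u c) →
                 ∀ c → insertZero k w c ≡ a * insertZero k u c
  insertZero-* zero    a w≡au zero    = sym (ℤP.*-zeroʳ a)
  insertZero-* zero    a w≡au (suc c) = w≡au c
  insertZero-* {suc n} (suc k) a w≡au zero    = w≡au zero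
  insertZero-* {suc n} (suc k) a w≡au (suc c) = insertZero-* k a (w≡au ∘ suc) c

  insertZero-δ : ∀ {n} (k : Fin (suc n)) r → insertZero k (δ r) ≗ δ (punchIn k r)
  insertZero-δ zero    r zero    = sym (δ-suc-zero r)
  insertZero-δ zero    r (suc c) = sym (δ-suc r c)
  insertZero-δ {suc n} (suc k) zero    zero    = sym (δ-refl (zero {suc n}))
  insertZero-δ {suc n} (suc k) (suc r) zero    = trans (δ-suc-zero r) (sym (δ-suc-zero (punchIn k r)))
  insertZero-δ {suc n} (suc k) zero    (suc c) =
    trans (insertZero-* k 0ℤ {u = off} {w = off} δ-zero-suc c) (sym (δ-zero-suc c))
    where
    off : Fin n → ℤ
    off x = δ (zero {n}) (suc x)
  insertZero-δ {suc n} (suc k) (suc r) (suc c) =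
    trans (insertZero-cong k (δ-suc r) c) (trans (insertZero-δ k r c) (sym (δ-suc (punchIn k r) c)))

  insertZero-decompose : ∀ {n} (k : Fin (suc n)) (w : Fin (suc n) → ℤ) c →
                         w c ≡ insertZero k (w ∘ punchIn k) c + w k * δ k c
  insertZero-decompose {n} zero w zero =
    trans (unit (w zero)) (cong (λ z → 0ℤ + w zero * z) (sym (δ-refl (zero {n}))))
    where
    unit : ∀ x → x ≡ 0ℤ + x * 1ℤ
    unit = solve-∀
  insertZero-decompose zero w (suc c) =
    sym (trans (cong (λ z → w (suc c) + w zero * z) (δ-zero-suc c))
               (trans (cong (w (suc c) +_) (ℤP.*-zeroʳ (w zero))) (ℤP.+-identityʳ _)))
  insertZero-decompose {suc n} (suc k) w zero =
    sym (trans (cong (λ z → w zero + w (suc k) * z) (δ-suc-zero k))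
               (trans (cong (w zero +_) (ℤP.*-zeroʳ (w (suc k)))) (ℤP.+-identityʳ _)))
  insertZero-decompose {suc n} (suc k) w (suc c) =
    trans (insertZero-decompose k (w ∘ suc) c)
          (cong (λ z → insertZero k (w ∘ suc ∘ punchIn k) c + w (suc k) * z) (sym (δ-suc k c)))

  bordered : ∀ {n} → Fin (suc n) → Mat n → Mat (suc n)
  bordered k Z zero    = δ k
  bordered k Z (suc r) = insertZero k (Z r)

  det-bordered : ∀ {n} (k : Fin (suc n)) (Z : Mat n) → det (bordered k Z) ≡ sign k * det Z
  det-bordered k Z = trans (det-unitRow (bordered k Z) k (λ _ → refl))
    (cong (sign k *_) (det-cong (minor (bordered k Z) k) Z (λ r → insertAt-punchIn (Z r) k 0ℤ)))

  det-I : ∀ {n} → det (I {n}) ≡ 1ℤ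
  det-I {zero}  = refl
  det-I {suc n} = begin
    det (I {suc n})                   ≡⟨ det-unitRow I (zero {n}) (λ _ → refl) ⟩
    1ℤ * det (minor (I {suc n}) zero) ≡⟨ ℤP.*-identityˡ _ ⟩
    det (minor (I {suc n}) zero)      ≡⟨ det-cong (minor I zero) (I {n}) δ-suc ⟩
    det (I {n})                       ≡⟨ det-I {n} ⟩
    1ℤ                                ∎
    where open ≡-Reasoning

  module _ {n} {g : Mat (suc n) → ℤ} (g-aml : IsAlternatingMultilinear g) where
    open IsAlternatingMultilinear g-aml

    bordered-alternatingMultilinear : ∀ k → IsAlternatingMultilinear (g ∘ bordered k)
    bordered-alternatingMultilinear k = record
      { multilinear = record
        { extensional = λ X Y X≗Y → extensional (bordered k X) (bordered k Y) (rows X≗Y)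
        ; additive    = λ r X Y Z X≈Z Y≈Z Zr →
            additive (suc r) (bordered k X) (bordered k Y) (bordered k Z)
                     (agreeOff X≈Z) (agreeOff Y≈Z) (insertZero-+ k Zr)
        ; homogeneous = λ r a X Z X≈Z Zr →
            homogeneous (suc r) a (bordered k X) (bordered k Z) (agreeOff X≈Z) (insertZero-* k a Zr)
        }
      ; alternating = λ X r r′ r≢r′ Xr≗Xr′ →
          alternating (bordered k X) (suc r) (suc r′) (r≢r′ ∘ suc-injective) (insertZero-cong k Xr≗Xr′)
      }
      where
      rows : ∀ {X Y} → (∀ r → X r ≗ Y r) → ∀ r → bordered k X r ≗ bordered k Y r
      rows X≗Y zero    _ = refl
      rows X≗Y (suc r)   = insertZero-cong k (X≗Y r)
      agreeOff : ∀ {r X Z} → RowsAgreeOff r X Z → RowsAgreeOff (suc r) (bordered k X) (bordered k Z)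
      agreeOff X≈Z zero     _      _ = refl
      agreeOff X≈Z (suc r′) r′≢r     = insertZero-cong k (X≈Z r′ (r′≢r ∘ cong suc))

    addRowMultiple : ∀ k (Y Y′ : Mat (suc n)) p a → ¬ p ≡ zero → Y zero ≗ δ k →
                     RowsAgreeOff p Y Y′ → (∀ c → Y′ p c ≡ Y p c + a * δ k c) → g Y′ ≡ g Y
    addRowMultiple k Y Y′ p a p≢0 Y0 Y≈Y′ Y′p = begin
      g Y′                                ≡⟨ additive p Y (updateRow Y p (λ c → a * δ k c)) Y′ Y≈Y′
                                               (λ r r≢p c → trans (updateRow-minimal Y p _ r r≢p c) (Y≈Y′ r r≢p c))
                                               (λ c → trans (Y′p c) (cong (Y p c +_) (sym (updateRow-updates Y p _ c)))) ⟩
      g Y + g (updateRow Y p (λ c → a * δ k c))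
                                          ≡⟨ cong (g Y +_) (homogeneous p a (updateRow Y p (δ k)) _ (updateRow-agreeOff Y p _ _)
                                               (λ c → trans (updateRow-updates Y p _ c) (cong (a *_) (sym (updateRow-updates Y p _ c))))) ⟩
      g Y + a * g (updateRow Y p (δ k))   ≡⟨ cong (λ z → g Y + a * z) (alternating (updateRow Y p (δ k)) zero p (p≢0 ∘ sym)
                                               (λ c → trans (updateRow-minimal Y p _ zero (p≢0 ∘ sym) c)
                                                            (trans (Y0 c) (sym (updateRow-updates Y p _ c))))) ⟩
      g Y + a * 0ℤ                        ≡⟨ trans (cong (g Y +_) (ℤP.*-zeroʳ a)) (ℤP.+-identityʳ (g Y)) ⟩
      g Y                                 ∎
      where open ≡-Reasoning

    addRowMultiples : ∀ k (T Y : Mat (suc n)) (x : Fin n → ℤ) → T zero ≗ δ k → Y zero ≗ T zero →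
                      (∀ r c → Y (suc r) c ≡ T (suc r) c + x r * δ k c) → g Y ≡ g T
    addRowMultiples k T Y x T0 Y0 Yr =
      trans (extensional Y (V (const true)) (λ { zero → Y0 ; (suc r) → Yr r }))
            (masked (count {n} (const true)) (const true) refl)
      where
      V : (Fin n → Bool) → Mat (suc n)
      V m zero          = T zero
      V m (suc r) c     = T (suc r) c + (if m r then x r else 0ℤ) * δ k c
      masked : ∀ N (m : Fin n → Bool) → count m ≡ N → g (V m) ≡ g T
      masked zero    m cm = extensional (V m) T rows
        where
        rows : ∀ r → V m r ≗ T r
        rows zero    c = refl
        rows (suc r) c rewrite count≡0⇒false m cm r = ℤP.+-identityʳ (T (suc r) c)
      masked (suc N) m cm with count-nonempty m (subst (0 <_) (sym cm) (s≤s z≤n))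
      ... | r , mr = trans (addRowMultiple k (V m′) (V m) (suc r) (x r) (λ ()) T0 rows row-r)
                           (masked N m′ (ℕP.suc-injective (trans (count-remove m r mr) cm)))
        where
        m′ : Fin n → Bool
        m′ = updateAt m r (const false)
        rows : RowsAgreeOff (suc r) (V m′) (V m)
        rows zero     _      _ = refl
        rows (suc r′) r′≢r c =
          cong (λ b → T (suc r′) c + (if b then x r′ else 0ℤ) * δ k c)
               (updateAt-minimal r′ r m (r′≢r ∘ cong suc))
        row-r : ∀ c → V m (suc r) c ≡ V m′ (suc r) c + x r * δ k c
        row-r c rewrite updateAt-updates r {const false} m | mr = pad (T (suc r) c) (x r * δ k c)
          where
          pad : ∀ a b → a + b ≡ a + 0ℤ * 0ℤ + b
          pad = solve-∀

  bordered-zero-I : ∀ {n} (r : Fin (suc n)) → bordered zero I r ≗ I r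
  bordered-zero-I zero    _ = refl
  bordered-zero-I (suc r)   = insertZero-δ zero r

  -- bordered (suc k) I is bordered zero (bordered k I) with its first two rows swapped.
  bordered-I : ∀ {n} {g : Mat (suc n) → ℤ} → IsAlternatingMultilinear g →
               (∀ Z → g (bordered zero Z) ≡ det Z * g (bordered zero I)) →
               ∀ k → g (bordered k I) ≡ sign k * g I
  bordered-I {n} {g} g-aml φ-mult zero =
    trans (IsAlternatingMultilinear.extensional g-aml _ I (bordered-zero-I {n})) (sym (ℤP.*-identityˡ (g I)))
  bordered-I {suc n} {g} g-aml φ-mult (suc k) = begin
    g (bordered (suc k) I)                        ≡⟨ sym (ℤP.neg-involutive _) ⟩
    - - g (bordered (suc k) I)                    ≡⟨ cong -_ (sym (antisymmetric g-aml (bordered (suc k) I) (bordered zero (bordered k I))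
                                                      zero (suc zero) (λ ()) (sym ∘ insertZero-δ (suc k) zero) (insertZero-δ zero k) rest)) ⟩
    - g (bordered zero (bordered k I))            ≡⟨ cong -_ (φ-mult (bordered k I)) ⟩
    - (det (bordered k I) * g (bordered zero I))  ≡⟨ cong -_ (cong₂ _*_ det-bordered-I (IsAlternatingMultilinear.extensional g-aml _ I bordered-zero-I)) ⟩
    - (sign k * g I)                              ≡⟨ ℤP.neg-distribˡ-* (sign k) (g I) ⟩
    sign (suc k) * g I                            ∎
    where
    open ≡-Reasoning
    det-bordered-I : det (bordered k I) ≡ sign k
    det-bordered-I = trans (det-bordered k I) (trans (cong (sign k *_) (det-I {n})) (ℤP.*-identityʳ (sign k)))
    rest : ∀ r → ¬ r ≡ zero → ¬ r ≡ suc zero → bordered zero (bordered k I) r ≗ bordered (suc k) I r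
    rest zero          0≢0 _   = contradiction refl 0≢0
    rest (suc zero)    _   1≢1 = contradiction refl 1≢1
    rest (suc (suc t)) _   _ c =
      trans (insertZero-cong zero (insertZero-δ k t) c)
            (trans (insertZero-δ zero (punchIn k t) c) (sym (insertZero-δ (suc k) (suc t) c)))

  det-unique : ∀ {n} {g : Mat n → ℤ} → IsAlternatingMultilinear g → ∀ X → g X ≡ det X * g I
  det-unique {zero}  g-aml X =
    trans (IsAlternatingMultilinear.extensional g-aml X I (λ ())) (sym (ℤP.*-identityˡ _))
  det-unique {suc n} {g} g-aml X = begin
    g X                                                          ≡⟨ expand-row multilinear zero X (λ k → cleared k)
                                                                      (λ k → updateRow-minimal X zero (δ k))
                                                                      (λ k → updateRow-updates X zero (δ k)) ⟩
    sumFin (λ k → X zero k * g (cleared k))                      ≡⟨ sumFin-cong (λ k → cong (X zero k *_) (g-cleared k)) ⟩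
    sumFin (λ k → X zero k * (det (minor X k) * (sign k * g I))) ≡⟨ sumFin-cong (λ k → regroup (X zero k) (det (minor X k)) (sign k) (g I)) ⟩
    sumFin (λ k → sign k * (X zero k * det (minor X k)) * g I)   ≡⟨ sumFin-*ʳ (g I) (λ k → sign k * (X zero k * det (minor X k))) ⟩
    det X * g I                                                  ∎
    where
    open ≡-Reasoning
    open IsAlternatingMultilinear g-aml
    regroup : ∀ a b c d → a * (b * (c * d)) ≡ c * (a * b) * d
    regroup = solve-∀
    φ : Fin (suc n) → Mat n → ℤ
    φ k = g ∘ bordered k
    φ-multiplicative : ∀ k Z → φ k Z ≡ det Z * φ k I
    φ-multiplicative k = det-unique (bordered-alternatingMultilinear g-aml k)
    φ-I : ∀ k → φ k I ≡ sign k * g I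
    φ-I = bordered-I g-aml (φ-multiplicative zero)
    cleared : Fin (suc n) → Mat (suc n)
    cleared k = updateRow X zero (δ k)
    g-cleared : ∀ k → g (cleared k) ≡ det (minor X k) * (sign k * g I)
    g-cleared k = begin
      g (cleared k)                        ≡⟨ addRowMultiples g-aml k (bordered k (minor X k)) (cleared k) (λ r → X (suc r) k)
                                                (λ _ → refl) (updateRow-updates X zero (δ k))
                                                (λ r c → trans (updateRow-minimal X zero (δ k) (suc r) (λ ()) c)
                                                               (insertZero-decompose k (X (suc r)) c)) ⟩
      φ k (minor X k)                      ≡⟨ φ-multiplicative k (minor X k) ⟩
      det (minor X k) * φ k I              ≡⟨ cong (det (minor X k) *_) (φ-I k) ⟩
      det (minor X k) * (sign k * g I)     ∎

  det-*ᴹ : ∀ {n} (X Y : Mat n) → det (X *ᴹ Y) ≡ det X * det Y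
  det-*ᴹ {n} X Y = trans (det-unique g-aml X) (cong (det X *_) (det-cong (I *ᴹ Y) Y (λ r c → sumFin-δˡ r (λ k → Y k c))))
    where
    *Y-cong : ∀ (X X′ : Mat n) r r′ → X r ≗ X′ r′ → (X *ᴹ Y) r ≗ (X′ *ᴹ Y) r′
    *Y-cong X X′ r r′ X≗X′ c = sumFin-cong (λ k → cong (_* Y k c) (X≗X′ k))
    *Y-agreeOff : ∀ {r} {X X′ : Mat n} → RowsAgreeOff r X X′ → RowsAgreeOff r (X *ᴹ Y) (X′ *ᴹ Y)
    *Y-agreeOff {X = X} {X′} X≈X′ r′ r′≢r = *Y-cong X X′ r′ r′ (X≈X′ r′ r′≢r)
    g-aml : IsAlternatingMultilinear (λ X → det (X *ᴹ Y))
    g-aml = record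
      { multilinear = record
        { extensional = λ X X′ X≗X′ → det-cong (X *ᴹ Y) (X′ *ᴹ Y) (λ r → *Y-cong X X′ r r (X≗X′ r))
        ; additive    = λ r X X′ Z X≈Z X′≈Z Zr → det-additive r (X *ᴹ Y) (X′ *ᴹ Y) (Z *ᴹ Y)
            (*Y-agreeOff X≈Z) (*Y-agreeOff X′≈Z)
            (λ c → trans (sumFin-cong (λ k → trans (cong (_* Y k c) (Zr k)) (ℤP.*-distribʳ-+ (Y k c) (X r k) (X′ r k))))
                         (sumFin-+ (λ k → X r k * Y k c) (λ k → X′ r k * Y k c)))
        ; homogeneous = λ r a X Z X≈Z Zr → det-homogeneous r a (X *ᴹ Y) (Z *ᴹ Y) (*Y-agreeOff X≈Z)
            (λ c → trans (sumFin-cong (λ k → trans (cong (_* Y k c) (Zr k)) (ℤP.*-assoc a (X r k) (Y k c))))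
                         (sumFin-*ˡ a (λ k → X r k * Y k c)))
        }
      ; alternating = λ X r r′ r≢r′ Xr≗Xr′ → det-alternating (X *ᴹ Y) r r′ r≢r′ (*Y-cong X X r r′ Xr≗Xr′)
      }

  det-scalar : ∀ {n} a → det {n} (λ r c → a * δ r c) ≡ a ^ n
  det-scalar {zero}  a = refl
  det-scalar {suc n} a = begin
    det aI                     ≡⟨ det-homogeneous zero a Y aI (updateRow-minimal aI zero (δ zero))
                                    (λ c → cong (a *_) (sym (updateRow-updates aI zero (δ zero) c))) ⟩
    a * det Y                  ≡⟨ cong (a *_) (det-unitRow Y zero (updateRow-updates aI zero (δ zero))) ⟩
    a * (1ℤ * det (minor Y zero)) ≡⟨ cong (a *_) (ℤP.*-identityˡ _) ⟩
    a * det (minor Y zero)     ≡⟨ cong (a *_) (det-cong (minor Y zero) (λ r c → a * δ r c) (λ r c → cong (a *_) (δ-suc r c))) ⟩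
    a * det {n} (λ r c → a * δ r c) ≡⟨ cong (a *_) (det-scalar {n} a) ⟩
    a * a ^ n                  ∎
    where
    open ≡-Reasoning
    aI : Mat (suc n)
    aI r c = a * δ r c
    Y : Mat (suc n)
    Y = updateRow aI zero (δ zero)

  -- det P ≠ 0 because (det P)² = Hⁿ, and it cancels from det P · det M₁ = det M₂ · det P.
  det-conjugate : ∀ {n} (P M₁ M₂ : Mat n) (H : ℤ) → ¬ H ≡ 0ℤ →
                  (∀ r c → (P *ᴹ P) r c ≡ H * δ r c) → (∀ r c → (P *ᴹ M₁) r c ≡ (M₂ *ᴹ P) r c) →
                  det M₁ ≡ det M₂
  det-conjugate {n} P M₁ M₂ H H≢0 P²≡HI PM₁≡M₂P =
    ℤP.*-cancelˡ-≡ (det P) (det M₁) (det M₂) {{≢-nonZero detP≢0}} (begin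
      det P * det M₁      ≡⟨ sym (det-*ᴹ P M₁) ⟩
      det (P *ᴹ M₁)       ≡⟨ det-cong (P *ᴹ M₁) (M₂ *ᴹ P) PM₁≡M₂P ⟩
      det (M₂ *ᴹ P)       ≡⟨ det-*ᴹ M₂ P ⟩
      det M₂ * det P      ≡⟨ ℤP.*-comm (det M₂) (det P) ⟩
      det P * det M₂      ∎)
    where
    open ≡-Reasoning
    detP≢0 : ¬ det P ≡ 0ℤ
    detP≢0 detP≡0 = H≢0 (ℤP.i^n≡0⇒i≡0 H n (begin
      H ^ n                            ≡⟨ sym (det-scalar {n} H) ⟩
      det {n} (λ r c → H * δ r c)      ≡⟨ sym (det-cong (P *ᴹ P) (λ r c → H * δ r c) P²≡HI) ⟩
      det (P *ᴹ P)                     ≡⟨ det-*ᴹ P P ⟩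
      det P * det P                    ≡⟨ cong (_* det P) detP≡0 ⟩
      0ℤ                               ∎))

  det-shift-conjugate : ∀ {n} (P A B : Mat n) (H : ℤ) → ¬ H ≡ 0ℤ →
                        (∀ r c → (P *ᴹ P) r c ≡ H * δ r c) → (∀ r c → (P *ᴹ A) r c ≡ (B *ᴹ P) r c) →
                        ∀ t → det (λ r c → t * δ r c - A r c) ≡ det (λ r c → t * δ r c - B r c)
  det-shift-conjugate P A B H H≢0 P²≡HI PA≡BP t = det-conjugate P _ _ H H≢0 P²≡HI shifted
    where
    shifted : ∀ r c → (P *ᴹ (λ r c → t * δ r c - A r c)) r c ≡ ((λ r c → t * δ r c - B r c) *ᴹ P) r c
    shifted r c = begin
      sumFin (λ k → P r k * (t * δ k c - A k c))            ≡⟨ sumFin-cong (λ k → expandˡ (P r k) t (δ k c) (A k c)) ⟩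
      sumFin (λ k → t * (P r k * δ k c) + - (P r k * A k c)) ≡⟨ sumFin-+ (λ k → t * (P r k * δ k c)) (λ k → - (P r k * A k c)) ⟩
      sumFin (λ k → t * (P r k * δ k c)) + sumFin (λ k → - (P r k * A k c))
        ≡⟨ cong₂ _+_ (trans (sumFin-*ˡ t (λ k → P r k * δ k c)) (cong (t *_) (sumFin-δʳ c (P r))))
                     (trans (sumFin-neg (λ k → P r k * A k c)) (cong -_ (PA≡BP r c))) ⟩
      t * P r c + - sumFin (λ k → B r k * P k c)
        ≡⟨ sym (cong₂ _+_ (trans (sumFin-*ˡ t (λ k → δ r k * P k c)) (cong (t *_) (sumFin-δˡ r (λ k → P k c))))
                          (sumFin-neg (λ k → B r k * P k c))) ⟩
      sumFin (λ k → t * (δ r k * P k c)) + sumFin (λ k → - (B r k * P k c))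
        ≡⟨ sym (sumFin-+ (λ k → t * (δ r k * P k c)) (λ k → - (B r k * P k c))) ⟩
      sumFin (λ k → t * (δ r k * P k c) + - (B r k * P k c)) ≡⟨ sumFin-cong (λ k → sym (expandʳ (P k c) t (δ r k) (B r k))) ⟩
      sumFin (λ k → (t * δ r k - B r k) * P k c)            ∎
      where
      open ≡-Reasoning
      expandˡ : ∀ p t d x → p * (t * d - x) ≡ t * (p * d) + - (p * x)
      expandˡ = solve-∀
      expandʳ : ∀ p t d x → (t * d - x) * p ≡ t * (d * p) + - (x * p)
      expandʳ = solve-∀

module Distance where
  open import Data.Nat using (ℕ; zero; suc; _+_; _≤_; z≤n; s≤s)
  import Data.Nat.Properties as ℕP
  open import Data.Fin using (Fin)
  open import Data.Product using (∃; ∃₂; _×_; _,_; proj₁; proj₂)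
  open import Data.Bool using (true; false)
  open import Data.Unit using (tt)
  open import Function using (_∘_)
  open import Relation.Nullary using (¬_; yes; no; Dec; contradiction)
  open import Relation.Binary.PropositionalEquality

  module _ {n} {G : Adj n} where

    _++ʷ_ : ∀ {u v w k l} → Walk G u v k → Walk G v w l → Walk G u w (k + l)
    here _     ++ʷ q = q
    step p e r ++ʷ q = step p e (r ++ʷ q)

    snocʷ : ∀ {u v w k} → Walk G u v k → G v w ≡ true → Walk G u w (suc k)
    snocʷ (here _)     e = step tt e (here tt)
    snocʷ (step p e′ r) e = step p e′ (snocʷ r e)

    reverseʷ : (∀ u v → G u v ≡ G v u) → ∀ {u v k} → Walk G u v k → Walk G v u k
    reverseʷ G-sym (here _)                        = here tt
    reverseʷ G-sym {u} (step {w = w} _ e r) = snocʷ (reverseʷ G-sym r) (trans (G-sym w u) e)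

    walkIn-last : ∀ {P : Fin n → Set} {u v k} → WalkIn G P u v k → P v
    walkIn-last (here p)     = p
    walkIn-last (step _ _ r) = walkIn-last r

    walkIn-transfer : ∀ {P : Fin n → Set} (G′ : Adj n) → (∀ x y → P x → P y → G x y ≡ true → G′ x y ≡ true) →
                      ∀ {u v k} → WalkIn G P u v k → Walk G′ u v k
    walkIn-transfer G′ G⊆G′ (here _)     = here tt
    walkIn-transfer G′ G⊆G′ (step p e r) = step tt (G⊆G′ _ _ p (head r) e) (walkIn-transfer G′ G⊆G′ r)
      where
      head : ∀ {P : Fin n → Set} {u v k} → WalkIn G P u v k → P u
      head (here p)     = p
      head (step p _ _) = p

  module Metric {n} (G : Adj n) (G-sym : ∀ u v → G u v ≡ G v u)
                (D : Fin n → Fin n → ℕ) (isD : IsDistanceMatrix G D) where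

    shortest : ∀ u v → Walk G u v (D u v)
    shortest u v = proj₁ (isD u v)

    minimal : ∀ {u v k} → Walk G u v k → D u v ≤ k
    minimal {u} {v} {k} = proj₂ (isD u v) k

    D-refl : ∀ u → D u u ≡ 0
    D-refl u = ℕP.n≤0⇒n≡0 (minimal (here tt))

    D≡0⇒≡ : ∀ {u v} → D u v ≡ 0 → u ≡ v
    D≡0⇒≡ {u} {v} D≡0 with subst (Walk G u v) D≡0 (shortest u v)
    ... | here _ = refl

    D≢0 : ∀ {u v} → ¬ u ≡ v → 1 ≤ D u v
    D≢0 u≢v = ℕP.n≢0⇒n>0 (u≢v ∘ D≡0⇒≡)

    D-sym : ∀ u v → D u v ≡ D v u
    D-sym u v = ℕP.≤-antisym (minimal (reverseʷ G-sym (shortest v u))) (minimal (reverseʷ G-sym (shortest u v)))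

    D-triangle : ∀ u w v → D u v ≤ D u w + D w v
    D-triangle u w v = minimal (shortest u w ++ʷ shortest w v)

    D-triangle₃ : ∀ u x y v → D u v ≤ D u x + D x y + D y v
    D-triangle₃ u x y v = ℕP.≤-trans (D-triangle u y v) (ℕP.+-monoˡ-≤ (D y v) (D-triangle u x y))

    D-edge : ∀ {u w} → G u w ≡ true → D u w ≤ 1
    D-edge e = minimal (step tt e (here tt))

    D-path₂ : ∀ {x y z} → G x y ≡ true → G y z ≡ true → D x z ≤ 2
    D-path₂ {x} {y} {z} xy yz = ℕP.≤-trans (D-triangle x y z) (ℕP.+-mono-≤ (D-edge xy) (D-edge yz))

    D-path₃ : ∀ {x y z w} → G x y ≡ true → G y z ≡ true → G z w ≡ true → D x w ≤ 3
    D-path₃ {x} {y} {z} {w} xy yz zw =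
      ℕP.≤-trans (D-triangle₃ x y z w) (ℕP.+-mono-≤ (ℕP.+-mono-≤ (D-edge xy) (D-edge yz)) (D-edge zw))

    D-stepˡ : ∀ {u w} v → G u w ≡ true → D u v ≤ suc (D w v)
    D-stepˡ v e = minimal (step tt e (shortest _ v))

    D-stepʳ : ∀ {u c y k} → D u c ≤ k → G c y ≡ true → D u y ≤ k + 1
    D-stepʳ {u} {c} {y} Duc≤k e = ℕP.≤-trans (D-triangle u c y) (ℕP.+-mono-≤ Duc≤k (D-edge e))

    D-firstStep : ∀ {u v k} → D u v ≡ suc k → ∃ λ w → G u w ≡ true × D w v ≡ k
    D-firstStep {u} {v} {k} D≡1+k with subst (Walk G u v) D≡1+k (shortest u v)
    ... | step {w = w} _ e r =
      w , e , ℕP.≤-antisym (minimal r) (ℕP.≤-pred (subst (_≤ suc (D w v)) D≡1+k (D-stepˡ v e)))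

    D≡1⇒edge : ∀ {u v} → D u v ≡ 1 → G u v ≡ true
    D≡1⇒edge {u} D≡1 with D-firstStep D≡1
    ... | w , e , Dwv≡0 = subst (λ z → G u z ≡ true) (D≡0⇒≡ Dwv≡0) e

    non-edge⇒D≥2 : ∀ {u v} → ¬ u ≡ v → G u v ≡ false → 2 ≤ D u v
    non-edge⇒D≥2 {u} {v} u≢v ¬e with D u v in D≡
    ... | zero        = contradiction (D≡0⇒≡ D≡) u≢v
    ... | suc zero    with () ← trans (sym (D≡1⇒edge D≡)) ¬e
    ... | suc (suc _) = s≤s (s≤s z≤n)

    firstExit : (W : Fin n → Set) → (∀ x → Dec (W x)) → ∀ {u v} → W u → ¬ W v →
                ∃₂ λ c a → ∃ λ k → WalkIn G W u c k × G c a ≡ true × ¬ W a × k + suc (D a v) ≡ D u v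
    firstExit W W? {u} {v} Wu ¬Wv = go (D u v) refl Wu
      where
      go : ∀ N {u} → D u v ≡ N → W u → ∃₂ λ c a → ∃ λ k →
           WalkIn G W u c k × G c a ≡ true × ¬ W a × k + suc (D a v) ≡ D u v
      go zero    D≡0 Wu = contradiction (subst W (D≡0⇒≡ D≡0) Wu) ¬Wv
      go (suc N) {u} D≡ Wu with D-firstStep D≡
      ... | w , e , Dwv≡N with W? w
      ...   | no ¬Ww = u , w , 0 , here Wu , e , ¬Ww , trans (cong suc Dwv≡N) (sym D≡)
      ...   | yes Ww with go N Dwv≡N Ww
      ...     | c , a , k , walk , ca , ¬Wa , len =
        c , a , suc k , step Wu e walk , ca , ¬Wa , trans (cong suc (trans len Dwv≡N)) (sym D≡)

module Partition {n m : ℕ} {ℓ : Fin m → ℕ} (part : Fin n → Part m ℓ) where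
  open import Data.Fin using (_≟_)
  open import Data.Bool using (true; false)
  open import Data.Product using (∃; _,_)
  open import Data.Sum using (_⊎_; inj₁; inj₂)
  open import Relation.Nullary using (¬_; yes; no; Dec; contradiction)
  open import Relation.Nullary.Decidable using (⌊_⌋)
  open import Relation.Binary.PropositionalEquality

  isA : Fin m → Fin n → Bool
  isA i v with part v
  ... | inA i′  = ⌊ i ≟ i′ ⌋
  ... | inB _ _ = false

  IsA : Fin m → Fin n → Set
  IsA i v = part v ≡ inA i

  IsB : (i : Fin m) → Fin (ℓ i) → Fin n → Set
  IsB i j v = part v ≡ inB i j

  AnyA : Fin n → Set
  AnyA v = ∃ λ i → IsA i v

  InBlock : Fin m → Fin n → Set
  InBlock i v = IsA i v ⊎ ∃ λ j → IsB i j v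

  data Kind (v : Fin n) : Set where
    kA : ∀ i → IsA i v → Kind v
    kB : ∀ i j → IsB i j v → Kind v

  kind : ∀ v → Kind v
  kind v with part v in pv
  ... | inA i   = kA i pv
  ... | inB i j = kB i j pv

  isA⇒IsA : ∀ {i v} → isA i v ≡ true → IsA i v
  isA⇒IsA {i} {v} e with part v
  ... | inB _ _ with () ← e
  ... | inA i′ with i ≟ i′
  ...   | yes refl = refl
  ...   | no _     with () ← e

  IsA⇒isA : ∀ {i v} → IsA i v → isA i v ≡ true
  IsA⇒isA {i} {v} pv rewrite pv with i ≟ i
  ... | yes _  = refl
  ... | no i≢i = contradiction refl i≢i

  ¬IsA⇒isA : ∀ {i v} → ¬ IsA i v → isA i v ≡ false
  ¬IsA⇒isA {i} {v} ¬iv with isA i v in e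
  ... | true  = contradiction (isA⇒IsA e) ¬iv
  ... | false = refl

  IsA-unique : ∀ {i k v} → IsA i v → IsA k v → i ≡ k
  IsA-unique iv kv with trans (sym iv) kv
  ... | refl = refl

  IsA⇒¬IsB : ∀ {i k j v} → IsA i v → ¬ IsB k j v
  IsA⇒¬IsB iv bv with trans (sym iv) bv
  ... | ()

  IsB-block : ∀ {i i′ j j′ v} → IsB i j v → IsB i′ j′ v → i ≡ i′
  IsB-block bv bv′ with trans (sym bv) bv′
  ... | refl = refl

  IsB? : ∀ i j v → Dec (IsB i j v)
  IsB? i j v with part v
  ... | inA _ = no λ ()
  ... | inB i′ j′ with i′ ≟ i
  ...   | no i′≢i = no λ { refl → i′≢i refl }
  ...   | yes refl with j′ ≟ j
  ...     | yes refl = yes refl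
  ...     | no j′≢j  = no λ { refl → j′≢j refl }

  InBlock? : ∀ i v → Dec (InBlock i v)
  InBlock? i v with kind v
  ... | kA i′ pv with i′ ≟ i
  ...   | yes refl = yes (inj₁ pv)
  ...   | no i′≢i  = no λ { (inj₁ iv) → i′≢i (IsA-unique pv iv) ; (inj₂ (_ , bv)) → IsA⇒¬IsB pv bv }
  InBlock? i v | kB i′ j′ pv with i′ ≟ i
  ...   | yes refl = yes (inj₂ (j′ , pv))
  ...   | no i′≢i  = no λ { (inj₁ iv) → IsA⇒¬IsB iv pv ; (inj₂ (_ , bv)) → i′≢i (IsB-block pv bv) }

  IsA⇒¬InBlock : ∀ {i k v} → IsA k v → ¬ k ≡ i → ¬ InBlock i v
  IsA⇒¬InBlock kv k≢i (inj₁ iv)       = k≢i (IsA-unique kv iv)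
  IsA⇒¬InBlock kv k≢i (inj₂ (_ , bv)) = IsA⇒¬IsB kv bv

  IsB⇒¬InBlock : ∀ {i k j v} → IsB k j v → ¬ k ≡ i → ¬ InBlock i v
  IsB⇒¬InBlock bv k≢i (inj₁ iv)        = IsA⇒¬IsB iv bv
  IsB⇒¬InBlock bv k≢i (inj₂ (_ , bv′)) = k≢i (IsB-block bv bv′)

module Switching {n m : ℕ} {ℓ : Fin m → ℕ} (part : Fin n → Part m ℓ)
                 (sel : (i : Fin m) → Fin (ℓ i) → Fin n → Bool) where
  open import Data.Nat using (zero; suc; _+_; _≤_; _<_; z≤n; s≤s)
  import Data.Nat.Properties as ℕP
  open import Data.Fin using (_≟_)
  open import Data.Vec.Functional using (updateAt)
  open import Data.Vec.Functional.Properties using (updateAt-minimal)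
  open import Data.Bool using (true; false; _∧_; _∨_; not; if_then_else_)
  open import Data.Bool.Properties using (∧-zeroʳ)
  open import Data.Empty using (⊥)
  open import Data.Product using (∃; _×_; _,_; proj₁; proj₂)
  open import Data.Sum using (_⊎_; inj₁; inj₂)
  open import Function using (_∘_; const)
  open import Relation.Nullary using (¬_; yes; no; contradiction)
  open import Relation.Binary.PropositionalEquality
  open import Data.Nat.Induction using (<-rec)
  open import Data.Nat.Tactic.RingSolver using (solve-∀)
  open Partition part
  open Counting

  record BlockStructure (G : Adj n) : Set where
    field
      G-sym         : ∀ u v → G u v ≡ G v u
      G-irreflexive : ∀ v → G v v ≡ false
      A-modules     : ∀ i k → ¬ i ≡ k → ∀ v → IsA i v →
                      (∀ w → IsA k w → G v w ≡ true) ⊎ (∀ w → IsA k w → G v w ≡ false)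
      B-B           : ∀ u v i j i′ j′ → IsB i j u → IsB i′ j′ v →
                      ¬ (_≡_ {A = Part m ℓ} (inB i j) (inB i′ j′)) → G u v ≡ false
      B-otherA      : ∀ u v i j i′ → IsB i j u → IsA i′ v → ¬ i ≡ i′ → G u v ≡ false
      B-A           : ∀ b i j → IsB i j b → (∀ w → IsA i w → G b w ≡ false) ⊎
                      (∀ w → IsA i w → G b w ≡ true) ⊎ (∀ w → IsA i w → G b w ≡ sel i j w)
      sel-sub       : ∀ i j v → sel i j v ≡ true → IsA i v
      half          : Fin m → ℕ
      size-A        : ∀ i → count (isA i) ≡ half i + half i
      size-sel      : ∀ i j → count (sel i j) ≡ half i
      degree        : Fin m → ℕ
      half≤degree   : ∀ i → half i ≤ degree i
      regular       : ∀ i v → IsA i v → count (λ w → G v w ∧ isA i w) ≡ degree i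

  record IsSwitching (G G′ : Adj n) : Set where
    field
      structure  : BlockStructure G
      G′-sym     : ∀ u v → G′ u v ≡ G′ v u
      keeps-AA   : ∀ u v → AnyA u → AnyA v → G u v ≡ true → G′ u v ≡ true
      keeps-BB   : ∀ u v i j → IsB i j u → IsB i j v → G u v ≡ true → G′ u v ≡ true
      keeps-full : ∀ c i j → IsB i j c → (∀ w → IsA i w → G c w ≡ true) → ∀ a → IsA i a → G′ c a ≡ true
      switches   : ∀ c i j → IsB i j c → (∀ w → IsA i w → G c w ≡ sel i j w) →
                   ∀ a → IsA i a → sel i j a ≡ false → G′ c a ≡ true
    open BlockStructure structure public

  module Blocks {G : Adj n} (bs : BlockStructure G) where
    open BlockStructure bs

    B-neighbour : ∀ {i j u w} → IsB i j u → G u w ≡ true → IsB i j w ⊎ IsA i w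
    B-neighbour {i} {j} {u} {w} bu e with kind w
    ... | kA i′ aw with i ≟ i′
    ...   | yes refl = inj₂ aw
    ...   | no i≢i′  with () ← trans (sym e) (B-otherA u w i j i′ bu aw i≢i′)
    B-neighbour {i} {j} {u} {w} bu e | kB i′ j′ bw with IsB? i j w
    ...   | yes bw′ = inj₁ bw′
    ...   | no ¬bw′ with () ← trans (sym e) (B-B u w i j i′ j′ bu bw (λ p → ¬bw′ (trans bw (sym p))))

    data ANeighbour (i : Fin m) (x : Fin n) : Set where
      same-A    : IsA i x → ANeighbour i x
      attached  : ∀ j → IsB i j x → ANeighbour i x
      dominates : ∀ k → ¬ k ≡ i → IsA k x → (∀ a → IsA i a → G x a ≡ true) → ANeighbour i x

    A-neighbour : ∀ {i a x} → IsA i a → G a x ≡ true → ANeighbour i x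
    A-neighbour {i} {a} {x} ia e with kind x
    ... | kA k kx with k ≟ i
    ...   | yes refl = same-A kx
    ...   | no k≢i with A-modules k i k≢i x kx
    ...     | inj₁ all  = dominates k k≢i kx all
    ...     | inj₂ none with () ← trans (sym e) (trans (G-sym a x) (none a ia))
    A-neighbour {i} {a} {x} ia e | kB k j bx with k ≟ i
    ...   | yes refl = attached j bx
    ...   | no k≢i   with () ← trans (sym e) (trans (G-sym a x) (B-otherA x a k j i bx ia k≢i))

    unselected : (i : Fin m) → Fin (ℓ i) → Fin n → Bool
    unselected i j w = isA i w ∧ not (sel i j w)

    isA∧sel : ∀ i j w → isA i w ∧ sel i j w ≡ sel i j w
    isA∧sel i j w with sel i j w in s
    ... | true  = cong (_∧ true) (IsA⇒isA (sel-sub i j w s))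
    ... | false = ∧-zeroʳ (isA i w)

    count-unselected : ∀ i j → count (unselected i j) ≡ half i
    count-unselected i j = ℕP.+-cancelˡ-≡ (half i) _ _ (begin
      half i + count (unselected i j)                           ≡⟨ cong (_+ count (unselected i j)) (sym (size-sel i j)) ⟩
      count (sel i j) + count (unselected i j)                  ≡⟨ cong (_+ count (unselected i j)) (sym (count-cong (isA∧sel i j))) ⟩
      count (λ w → isA i w ∧ sel i j w) + count (unselected i j) ≡⟨ sym (count-split (isA i) (sel i j)) ⟩
      count (isA i)                                             ≡⟨ size-A i ⟩
      half i + half i                                           ∎)
      where open ≡-Reasoning

    neighboursIn : Fin m → Fin n → Fin n → Bool
    neighboursIn i a w = G a w ∧ isA i w

    neighboursIn-≢ : ∀ {i a w} → neighboursIn i a w ≡ true → ¬ w ≡ a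
    neighboursIn-≢ {a = a} e refl with () ← trans (sym (proj₁ (∧-true e))) (G-irreflexive a)

    remove : Fin n → (Fin n → Bool) → Fin n → Bool
    remove a f = updateAt f a (const false)

    remove-keeps : ∀ a (f : Fin n → Bool) w → ¬ w ≡ a → f w ≡ true → remove a f w ≡ true
    remove-keeps a f w w≢a fw = trans (updateAt-minimal w a f w≢a) fw

    count-A-minus : ∀ {i a} → IsA i a → suc (count (remove a (isA i))) ≡ half i + half i
    count-A-minus {i} {a} ia = trans (count-remove (isA i) a (IsA⇒isA ia)) (size-A i)

    half-pos : ∀ {i a} → IsA i a → 0 < half i
    half-pos {i} {a} ia with half i in h≡
    ... | suc _ = s≤s z≤n
    ... | zero  with () ← trans (count-A-minus ia) (cong (λ h → h + h) h≡)

    selected-nonempty : ∀ {i a} (j : Fin (ℓ i)) → IsA i a → ∃ λ w → sel i j w ≡ true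
    selected-nonempty {i} j ia = count-nonempty (sel i j) (subst (0 <_) (sym (size-sel i j)) (half-pos ia))

    unselected-nonempty : ∀ {i a} (j : Fin (ℓ i)) → IsA i a → ∃ λ w → IsA i w × sel i j w ≡ false
    unselected-nonempty {i} j ia with count-nonempty (unselected i j) (subst (0 <_) (sym (count-unselected i j)) (half-pos ia))
    ... | w , e = w , isA⇒IsA (proj₁ (∧-true e)) , not-true (proj₂ (∧-true e))

    -- The neighbourhood of a in A^i (size ≥ half) and a half avoiding a cannot fit disjointly in A^i ∖ {a}.
    neighbour-in-selected : ∀ {i a} (j : Fin (ℓ i)) → IsA i a → sel i j a ≡ false →
                            ∃ λ w → sel i j w ≡ true × G a w ≡ true
    neighbour-in-selected {i} {a} j ia sa with pigeonhole (neighboursIn i a) (sel i j) (remove a (isA i)) inside small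
      where
      inside : ∀ x → neighboursIn i a x ∨ sel i j x ≡ true → remove a (isA i) x ≡ true
      inside x e with ∨-true e
      ... | inj₁ nx = remove-keeps a (isA i) x (neighboursIn-≢ nx) (proj₂ (∧-true nx))
      ... | inj₂ sx = remove-keeps a (isA i) x (λ { refl → contradiction (trans (sym sx) sa) λ () })
                                   (IsA⇒isA (sel-sub i j x sx))
      small : count (remove a (isA i)) < count (neighboursIn i a) + count (sel i j)
      small = subst₂ _≤_ (sym (count-A-minus ia)) (cong₂ _+_ (sym (regular i a ia)) (sym (size-sel i j)))
                     (ℕP.+-monoˡ-≤ (half i) (half≤degree i))
    ... | w , nw , sw = w , sw , proj₁ (∧-true nw)

    neighbour-in-unselected : ∀ {i a} (j : Fin (ℓ i)) → IsA i a → sel i j a ≡ true →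
                              ∃ λ w → IsA i w × sel i j w ≡ false × G a w ≡ true
    neighbour-in-unselected {i} {a} j ia sa with pigeonhole (neighboursIn i a) (unselected i j) (remove a (isA i)) inside small
      where
      inside : ∀ x → neighboursIn i a x ∨ unselected i j x ≡ true → remove a (isA i) x ≡ true
      inside x e with ∨-true e
      ... | inj₁ nx = remove-keeps a (isA i) x (neighboursIn-≢ nx) (proj₂ (∧-true nx))
      ... | inj₂ ux = remove-keeps a (isA i) x (λ { refl → contradiction (trans (sym sa) (not-true (proj₂ (∧-true ux)))) λ () })
                                   (proj₁ (∧-true ux))
      small : count (remove a (isA i)) < count (neighboursIn i a) + count (unselected i j)
      small = subst₂ _≤_ (sym (count-A-minus ia)) (cong₂ _+_ (sym (regular i a ia)) (sym (count-unselected i j)))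
                     (ℕP.+-monoˡ-≤ (half i) (half≤degree i))
    ... | w , nw , uw = w , isA⇒IsA (proj₁ (∧-true uw)) , not-true (proj₂ (∧-true uw)) , proj₁ (∧-true nw)

    common-neighbour : ∀ {i a a′} → IsA i a → IsA i a′ → ¬ a ≡ a′ → G a a′ ≡ false →
                       ∃ λ w → IsA i w × G a w ≡ true × G w a′ ≡ true
    common-neighbour {i} {a} {a′} ia ia′ a≢a′ ¬aa′
      with pigeonhole (neighboursIn i a) (neighboursIn i a′) (remove a′ (remove a (isA i))) inside small
      where
      not-adjacent : ∀ {x y} → G x y ≡ false → neighboursIn i x y ≡ true → ⊥
      not-adjacent ¬xy nxy with () ← trans (sym (proj₁ (∧-true nxy))) ¬xy
      inside : ∀ x → neighboursIn i a x ∨ neighboursIn i a′ x ≡ true → remove a′ (remove a (isA i)) x ≡ true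
      inside x e with ∨-true e
      ... | inj₁ nx = remove-keeps a′ _ x (λ { refl → not-adjacent ¬aa′ nx })
                        (remove-keeps a (isA i) x (neighboursIn-≢ nx) (proj₂ (∧-true nx)))
      ... | inj₂ nx = remove-keeps a′ _ x (neighboursIn-≢ nx)
                        (remove-keeps a (isA i) x (λ { refl → not-adjacent (trans (G-sym a′ a) ¬aa′) nx }) (proj₂ (∧-true nx)))
      small : count (remove a′ (remove a (isA i))) < count (neighboursIn i a) + count (neighboursIn i a′)
      small = ℕP.≤-trans (ℕP.n≤1+n _)
                (subst₂ _≤_ (sym (trans (cong suc (count-remove _ a′ (remove-keeps a (isA i) a′ (a≢a′ ∘ sym) (IsA⇒isA ia′))))
                                        (count-A-minus ia)))
                            (cong₂ _+_ (sym (regular i a ia)) (sym (regular i a′ ia′)))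
                            (ℕP.+-mono-≤ (half≤degree i) (half≤degree i)))
    ... | w , nw , nw′ = w , isA⇒IsA (proj₂ (∧-true nw)) , proj₁ (∧-true nw) , trans (G-sym w a′) (proj₁ (∧-true nw′))

    common-unselected : ∀ {i a} (j j′ : Fin (ℓ i)) → sel i j a ≡ true → sel i j′ a ≡ true →
                        ∃ λ w → IsA i w × sel i j w ≡ false × sel i j′ w ≡ false
    common-unselected {i} {a} j j′ sa sa′ with count-<⇒difference (λ w → sel i j w ∨ sel i j′ w) (isA i) small
      where
      both : 0 < count (λ w → sel i j w ∧ sel i j′ w)
      both = subst (0 <_) (count-remove _ a (cong₂ _∧_ sa sa′)) (s≤s z≤n)
      small : count (λ w → sel i j w ∨ sel i j′ w) < count (isA i)
      small = subst₂ _≤_ (ℕP.+-comm _ 1)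
                         (trans (count-∨-∧ (sel i j) (sel i j′)) (trans (cong₂ _+_ (size-sel i j) (size-sel i j′)) (sym (size-A i))))
                         (ℕP.+-monoʳ-≤ (count (λ w → sel i j w ∨ sel i j′ w)) both)
    ... | w , aw , e = w , isA⇒IsA aw , ∨-false e

  module Comparison {G G′ : Adj n} (sw : IsSwitching G G′)
                    (D D′ : Fin n → Fin n → ℕ) (isD : IsDistanceMatrix G D) (isD′ : IsDistanceMatrix G′ D′) where
    open IsSwitching sw
    open Blocks structure
    open Distance using (walkIn-last; walkIn-transfer)
    module M  = Distance.Metric G G-sym D isD
    module M′ = Distance.Metric G′ G′-sym D′ isD′

    record Exit (i : Fin m) (j : Fin (ℓ i)) (u v : Fin n) : Set where
      field
        c a  : Fin n
        dc   : ℕ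
        D′uc : D′ u c ≤ dc
        Duc  : D u c ≤ dc
        c∈B  : IsB i j c
        ca   : G c a ≡ true
        a∈A  : IsA i a
        len  : dc + suc (D a v) ≡ D u v

      lower : dc + 1 ≤ D u v
      lower = ℕP.≤-trans (ℕP.+-monoʳ-≤ dc (s≤s z≤n)) (ℕP.≤-reflexive len)

    exit : ∀ {i j u v} → IsB i j u → ¬ IsB i j v → Exit i j u v
    exit {i} {j} bu ¬bv with M.firstExit (IsB i j) (IsB? i j) bu ¬bv
    ... | c , a , k , walk , ca , ¬ba , len with B-neighbour (walkIn-last walk) ca
    ...   | inj₁ ba = contradiction ba ¬ba
    ...   | inj₂ ia = record
      { c = c ; a = a ; dc = k
      ; D′uc = M′.minimal (walkIn-transfer G′ (λ x y bx by → keeps-BB x y i j bx by) walk)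
      ; Duc  = M.minimal (walkIn-transfer G (λ _ _ _ _ e → e) walk)
      ; c∈B = walkIn-last walk ; ca = ca ; a∈A = ia ; len = len }

    A-diameter : ∀ {i a a′} → IsA i a → IsA i a′ → D a a′ ≤ 2
    A-diameter {i} {a} {a′} ia ia′ with a ≟ a′
    ... | yes refl = ℕP.≤-trans (ℕP.≤-reflexive (M.D-refl a)) z≤n
    ... | no a≢a′ with G a a′ in e
    ...   | true  = ℕP.m≤n⇒m≤1+n (M.D-edge e)
    ...   | false with common-neighbour ia ia′ a≢a′ e
    ...     | _ , _ , aw , wa′ = M.D-path₂ aw wa′

    A-diameter′ : ∀ {i a a′} → IsA i a → IsA i a′ → D′ a a′ ≤ 2
    A-diameter′ {i} {a} {a′} ia ia′ with a ≟ a′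
    ... | yes refl = ℕP.≤-trans (ℕP.≤-reflexive (M′.D-refl a)) z≤n
    ... | no a≢a′ with G a a′ in e
    ...   | true  = ℕP.m≤n⇒m≤1+n (M′.D-edge (keeps-AA a a′ (i , ia) (i , ia′) e))
    ...   | false with common-neighbour ia ia′ a≢a′ e
    ...     | w , iw , aw , wa′ = M′.D-path₂ (keeps-AA a w (i , ia) (i , iw) aw) (keeps-AA w a′ (i , iw) (i , ia′) wa′)

    -- A shortest walk from A^i to v ∉ A^i ∪ B^i leaves through a vertex adjacent to all of A^i.
    A-equidistant-≤ : ∀ {i v a a′} → ¬ InBlock i v → IsA i a → IsA i a′ → D a v ≤ D a′ v
    A-equidistant-≤ {i} {v} {a} {a′} ¬iv ia ia′ with M.firstExit (InBlock i) (InBlock? i) (inj₁ ia′) ¬iv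
    ... | c , x , k , walk , cx , ¬ix , len with walkIn-last walk
    ...   | inj₂ (j , bc) with B-neighbour bc cx
    ...     | inj₁ bx = contradiction (inj₂ (j , bx)) ¬ix
    ...     | inj₂ ix = contradiction (inj₁ ix) ¬ix
    A-equidistant-≤ {i} {v} {a} ¬iv ia ia′ | c , x , k , walk , cx , ¬ix , len | inj₁ ic with A-neighbour ic cx
    ...     | same-A ix        = contradiction (inj₁ ix) ¬ix
    ...     | attached j bx    = contradiction (inj₂ (j , bx)) ¬ix
    ...     | dominates _ _ _ all = ℕP.≤-trans (M.D-stepˡ v (trans (G-sym a x) (all a ia)))
                                      (ℕP.≤-trans (ℕP.m≤n+m _ k) (ℕP.≤-reflexive len))

    A-equidistant : ∀ {i v a a′} → ¬ InBlock i v → IsA i a → IsA i a′ → D a v ≡ D a′ v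
    A-equidistant ¬iv ia ia′ = ℕP.≤-antisym (A-equidistant-≤ ¬iv ia ia′) (A-equidistant-≤ ¬iv ia′ ia)

    -- A shortest walk passing through some B^i_j enters and leaves it through A^i, so that stretch
    -- can be replaced by at most two edges inside A^i, which G′ keeps.
    D′≤D-AA : ∀ {u v} → AnyA u → AnyA v → D′ u v ≤ D u v
    D′≤D-AA {u} {v} au av = <-rec P induct (D u v) au refl
      where
      P : ℕ → Set
      P k = ∀ {u} → AnyA u → D u v ≡ k → D′ u v ≤ k
      induct : ∀ k → (∀ {k′} → k′ < k → P k′) → P k
      induct zero    _   {u} _  D≡0 rewrite M.D≡0⇒≡ D≡0 = ℕP.≤-reflexive (M′.D-refl v)
      induct (suc k) rec {u} au D≡ with M.D-firstStep D≡
      ... | w , uw , Dwv≡k with kind w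
      ...   | kA i iw = ℕP.≤-trans (M′.D-stepˡ v (keeps-AA u w au (i , iw) uw)) (s≤s (rec ℕP.≤-refl (i , iw) Dwv≡k))
      ...   | kB i j bw with B-neighbour bw (trans (G-sym w u) uw)
      ...     | inj₁ bu = contradiction bu (IsA⇒¬IsB (proj₂ au))
      ...     | inj₂ iu = ℕP.≤-trans (M′.D-triangle u a v)
                            (ℕP.≤-trans (ℕP.+-mono-≤ (A-diameter′ iu a∈A) (rec Dav<k+1 (i , a∈A) refl)) (s≤s Dav<k))
        where
        open Exit (exit bw (IsA⇒¬IsB (proj₂ av)))
        Dav<k : D a v < k
        Dav<k = ℕP.≤-trans (ℕP.m≤n+m _ dc) (ℕP.≤-reflexive (trans len Dwv≡k))
        Dav<k+1 : D a v < suc k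
        Dav<k+1 = ℕP.m≤n⇒m≤1+n Dav<k

    reattached : ∀ {i j c a} → IsB i j c → IsA i a → G c a ≡ true → ∃ λ y → IsA i y × G′ c y ≡ true
    reattached {i} {j} {c} {a} bc ia ca with B-A c i j bc
    ... | inj₁ none        with () ← trans (sym ca) (none a ia)
    ... | inj₂ (inj₁ full) = a , ia , keeps-full c i j bc full a ia
    ... | inj₂ (inj₂ S) with unselected-nonempty j ia
    ...   | y , iy , sy = y , iy , switches c i j bc S y iy sy

    D′≤D-B-otherA : ∀ {i j k u v} → IsB i j u → IsA k v → ¬ k ≡ i → D′ u v ≤ D u v
    D′≤D-B-otherA {i} {j} {k} {u} {v} bu kv k≢i with reattached c∈B a∈A ca
      where open Exit (exit bu (IsA⇒¬IsB kv))
    ... | y , iy , cy = begin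
      D′ u v                ≤⟨ M′.D-triangle u c v ⟩
      D′ u c + D′ c v       ≤⟨ ℕP.+-mono-≤ D′uc (M′.D-stepˡ v cy) ⟩
      dc + suc (D′ y v)     ≤⟨ ℕP.+-monoʳ-≤ dc (s≤s (D′≤D-AA (i , iy) (k , kv))) ⟩
      dc + suc (D y v)      ≡⟨ cong (λ d → dc + suc d) (A-equidistant (IsA⇒¬InBlock kv k≢i) iy a∈A) ⟩
      dc + suc (D a v)      ≡⟨ len ⟩
      D u v                 ∎
      where open ℕP.≤-Reasoning
            open Exit (exit bu (IsA⇒¬IsB kv))

    -- If a = a′, the two selected halves share a and so their complements meet; otherwise a path
    -- of length 3 through the unselected halves suffices.
    attachments-close : ∀ {i j j′ c c′ a a′} → IsB i j c → IsB i j′ c′ → IsA i a → IsA i a′ →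
                        G c a ≡ true → G c′ a′ ≡ true → D′ c c′ ≤ 2 + D a a′
    attachments-close {i} {j} {j′} {c} {c′} {a} {a′} bc bc′ ia ia′ ca ca′ with B-A c i j bc | B-A c′ i j′ bc′
    ... | inj₁ none | _ with () ← trans (sym ca) (none a ia)
    ... | _ | inj₁ none with () ← trans (sym ca′) (none a′ ia′)
    ... | inj₂ (inj₁ full) | _ with reattached bc′ ia′ ca′
    ...   | y , iy , c′y = ℕP.≤-trans (M′.D-path₂ (keeps-full c i j bc full y iy) (trans (G′-sym y c′) c′y))
                                      (ℕP.m≤m+n 2 _)
    attachments-close {i} {j} {j′} {c} {c′} {a} {a′} bc bc′ ia ia′ ca ca′ | inj₂ (inj₂ S) | inj₂ (inj₁ full′)
      with reattached bc ia ca
    ...   | y , iy , cy = ℕP.≤-trans (M′.D-path₂ cy (trans (G′-sym y c′) (keeps-full c′ i j′ bc′ full′ y iy)))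
                                     (ℕP.m≤m+n 2 _)
    attachments-close {i} {j} {j′} {c} {c′} {a} {a′} bc bc′ ia ia′ ca ca′ | inj₂ (inj₂ S) | inj₂ (inj₂ S′)
      with D a a′ in Daa′
    ... | zero  with M.D≡0⇒≡ Daa′
    ...   | refl with common-unselected j j′ (trans (sym (S a ia)) ca) (trans (sym (S′ a ia)) ca′)
    ...     | w , iw , sw , s′w = via w iw sw s′w
      where
      via : ∀ w → IsA i w → sel i j w ≡ false → sel i j′ w ≡ false → D′ c c′ ≤ 2
      via w iw sw s′w = M′.D-path₂ (switches c i j bc S w iw sw) (trans (G′-sym w c′) (switches c′ i j′ bc′ S′ w iw s′w))
    attachments-close {i} {j} {j′} {c} {c′} {a} {a′} bc bc′ ia ia′ ca ca′ | inj₂ (inj₂ S) | inj₂ (inj₂ S′)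
      | suc _ with unselected-nonempty j ia
    ...   | y , iy , sy with sel i j′ y in s′y
    ...     | false = ℕP.≤-trans (M′.D-path₂ (switches c i j bc S y iy sy) (trans (G′-sym y c′) (switches c′ i j′ bc′ S′ y iy s′y)))
                                 (ℕP.m≤n⇒m≤1+n (ℕP.m≤m+n 2 _))
    ...     | true with neighbour-in-unselected j′ iy s′y
    ...       | y′ , iy′ , s′y′ , yy′ =
      ℕP.≤-trans (M′.D-path₃ (switches c i j bc S y iy sy) (keeps-AA y y′ (i , iy) (i , iy′) yy′)
                             (trans (G′-sym y′ c′) (switches c′ i j′ bc′ S′ y′ iy′ s′y′)))
                 (ℕP.+-monoʳ-≤ 2 (s≤s z≤n))

    D′≤D-BB-apart : ∀ {i j k j′ u v} → IsB i j u → IsB k j′ v → ¬ IsB i j v → D′ u v ≤ D u v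
    D′≤D-BB-apart {i} {j} {k} {j′} {u} {v} bu bv ¬bv with k ≟ i
    ... | no k≢i with reattached c∈B a∈A ca
      where open Exit (exit bu ¬bv)
    ...   | y , iy , cy = begin
      D′ u v                ≤⟨ M′.D-triangle u c v ⟩
      D′ u c + D′ c v       ≤⟨ ℕP.+-mono-≤ D′uc (M′.D-stepˡ v cy) ⟩
      dc + suc (D′ y v)     ≡⟨ cong (λ d → dc + suc d) (M′.D-sym y v) ⟩
      dc + suc (D′ v y)     ≤⟨ ℕP.+-monoʳ-≤ dc (s≤s (D′≤D-B-otherA bv iy (k≢i ∘ sym))) ⟩
      dc + suc (D v y)      ≡⟨ cong (λ d → dc + suc d) (trans (M.D-sym v y) (A-equidistant (IsB⇒¬InBlock bv k≢i) iy a∈A)) ⟩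
      dc + suc (D a v)      ≡⟨ len ⟩
      D u v                 ∎
      where open ℕP.≤-Reasoning
            open Exit (exit bu ¬bv)
    D′≤D-BB-apart {i} {j} {k} {j′} {u} {v} bu bv ¬bv | yes refl = begin
      D′ u v                                      ≤⟨ M′.D-triangle₃ u c c′ v ⟩
      D′ u c + D′ c c′ + D′ c′ v                  ≤⟨ ℕP.+-mono-≤ (ℕP.+-mono-≤ D′uc (attachments-close c∈B c′∈B a∈A a′∈A ca c′a′))
                                                                 (ℕP.≤-trans (ℕP.≤-reflexive (M′.D-sym c′ v)) D′vc′) ⟩
      dc + (2 + D a a′) + dc′                     ≡⟨ regroup dc (D a a′) dc′ ⟩
      dc + suc (dc′ + suc (D a a′))               ≡⟨ cong (λ d → dc + suc (dc′ + suc d)) (M.D-sym a a′) ⟩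
      dc + suc (dc′ + suc (D a′ a))               ≡⟨ cong (λ d → dc + suc d) (trans len′ (M.D-sym v a)) ⟩
      dc + suc (D a v)                            ≡⟨ len ⟩
      D u v                                       ∎
      where
      open ℕP.≤-Reasoning
      open Exit (exit bu ¬bv)
      open Exit (exit bv (IsA⇒¬IsB a∈A)) using () renaming
        (c to c′; a to a′; dc to dc′; D′uc to D′vc′; c∈B to c′∈B; a∈A to a′∈A; ca to c′a′; len to len′)
      regroup : ∀ x y z → x + (2 + y) + z ≡ x + suc (z + suc y)
      regroup = solve-∀

    D′≤D-BB-within : ∀ {i j u v} → IsB i j u → IsB i j v → D′ u v ≤ D u v
    D′≤D-BB-within {i} {j} {u} {v} bu bv = go (D u v) bu refl
      where
      go : ∀ k {u} → IsB i j u → D u v ≡ k → D′ u v ≤ k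
      go zero    {u} _  D≡0 rewrite M.D≡0⇒≡ D≡0 = ℕP.≤-reflexive (M′.D-refl v)
      go (suc k) {u} bu D≡ with M.D-firstStep D≡
      ... | w , uw , Dwv≡k with B-neighbour bu uw
      ...   | inj₁ bw = ℕP.≤-trans (M′.D-stepˡ v (keeps-BB u w i j bu bw uw)) (s≤s (go k bw Dwv≡k))
      ...   | inj₂ iw = begin
        D′ u v                                ≤⟨ M′.D-triangle u c v ⟩
        D′ u c + D′ c v                       ≤⟨ ℕP.+-mono-≤ (attachments-close bu c∈B iw a∈A uw ca)
                                                             (ℕP.≤-trans (ℕP.≤-reflexive (M′.D-sym c v)) D′uc) ⟩
        2 + D w a + dc                        ≡⟨ regroup (D w a) dc ⟩
        suc (dc + suc (D w a))                ≡⟨ cong (λ d → suc (dc + suc d)) (M.D-sym w a) ⟩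
        suc (dc + suc (D a w))                ≡⟨ cong suc (trans len (trans (M.D-sym v w) Dwv≡k)) ⟩
        suc k                                 ∎
        where
        open ℕP.≤-Reasoning
        open Exit (exit bv (IsA⇒¬IsB iw))
        regroup : ∀ x y → 2 + x + y ≡ suc (y + suc x)
        regroup = solve-∀

    D′≤D-BB : ∀ {i j k j′ u v} → IsB i j u → IsB k j′ v → D′ u v ≤ D u v
    D′≤D-BB {i} {j} {u = u} {v} bu bv with IsB? i j v
    ... | yes bv′ = D′≤D-BB-within bu bv′
    ... | no ¬bv  = D′≤D-BB-apart bu bv ¬bv

    data ExitKind (i : Fin m) (j : Fin (ℓ i)) (c : Fin n) : Set where
      full     : (∀ w → IsA i w → G c w ≡ true) → ExitKind i j c
      switched : (∀ w → IsA i w → G c w ≡ sel i j w) → ExitKind i j c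

    exitKind : ∀ {i j c a} → IsB i j c → IsA i a → G c a ≡ true → ExitKind i j c
    exitKind {i} {j} {c} {a} bc ia ca with B-A c i j bc
    ... | inj₁ none        with () ← trans (sym ca) (none a ia)
    ... | inj₂ (inj₁ all)  = full all
    ... | inj₂ (inj₂ S)    = switched S

    module ExitTo {i j u t} (bu : IsB i j u) (it : IsA i t) where
      open Exit (exit bu (IsA⇒¬IsB it)) public

      kindᶜ : ExitKind i j c
      kindᶜ = exitKind c∈B a∈A ca

      reach-full : (∀ w → IsA i w → G c w ≡ true) → ∀ {a′} → IsA i a′ → D u a′ ≤ dc + 1
      reach-full all ia′ = M.D-stepʳ Duc (all _ ia′)

      reach-selected : (∀ w → IsA i w → G c w ≡ sel i j w) → ∀ {a′} → IsA i a′ → sel i j a′ ≡ true → D u a′ ≤ dc + 1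
      reach-selected S ia′ sa′ = M.D-stepʳ Duc (trans (S _ ia′) sa′)

      reach-unselected : (∀ w → IsA i w → G c w ≡ sel i j w) → ∀ {a′} → IsA i a′ → sel i j a′ ≡ false → D u a′ ≤ dc + 2
      reach-unselected S {a′} ia′ sa′ with neighbour-in-selected j ia′ sa′
      ... | w , sw , a′w = ℕP.≤-trans (M.D-stepʳ (reach-selected S (sel-sub i j w sw) sw) (trans (G-sym w a′) a′w))
                                      (ℕP.≤-reflexive (ℕP.+-assoc dc 1 1))

      unselected-far : (∀ w → IsA i w → G c w ≡ sel i j w) → sel i j t ≡ false → dc + 2 ≤ D u t
      unselected-far S st = ℕP.≤-trans (ℕP.+-monoʳ-≤ dc (s≤s (M.D≢0 a≢t))) (ℕP.≤-reflexive len)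
        where
        a≢t : ¬ a ≡ t
        a≢t a≡t with () ← trans (sym (trans (sym (S a a∈A)) ca)) (trans (cong (sel i j) a≡t) st)

    Flat : Fin m → Fin n → Set
    Flat i u = ∀ a a′ → IsA i a → IsA i a′ → D u a ≡ D u a′

    Step : (i : Fin m) → Fin (ℓ i) → Fin n → ℕ → Set
    Step i j u f = ∀ a → IsA i a → D u a ≡ f + ind (not (sel i j a))

    module _ {i j u} (bu : IsB i j u) where
      private module E {t} (it : IsA i t) = ExitTo bu it

      selected-level : ∀ {a a′} → IsA i a → IsA i a′ → sel i j a ≡ true → sel i j a′ ≡ true → D u a′ ≤ D u a
      selected-level ia ia′ sa sa′ with E.kindᶜ ia
      ... | full all    = ℕP.≤-trans (E.reach-full ia all ia′) (E.lower ia)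
      ... | switched S  = ℕP.≤-trans (E.reach-selected ia S ia′ sa′) (E.lower ia)

      unselected-level : ∀ {a a′} → IsA i a → IsA i a′ → sel i j a ≡ false → sel i j a′ ≡ false → D u a′ ≤ D u a
      unselected-level ia ia′ sa sa′ with E.kindᶜ ia
      ... | full all    = ℕP.≤-trans (E.reach-full ia all ia′) (E.lower ia)
      ... | switched S  = ℕP.≤-trans (E.reach-unselected ia S ia′ sa′) (E.unselected-far ia S sa)

      selected≤unselected : ∀ {a a′} → IsA i a → IsA i a′ → sel i j a ≡ true → sel i j a′ ≡ false → D u a ≤ D u a′
      selected≤unselected ia ia′ sa sa′ with E.kindᶜ ia′
      ... | full all    = ℕP.≤-trans (E.reach-full ia′ all ia) (E.lower ia′)
      ... | switched S  = ℕP.≤-trans (E.reach-selected ia′ S ia sa) (E.lower ia′)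

      unselected≤selected+1 : ∀ {a a′} → IsA i a → IsA i a′ → sel i j a ≡ true → sel i j a′ ≡ false → D u a′ ≤ suc (D u a)
      unselected≤selected+1 ia ia′ sa sa′ with E.kindᶜ ia
      ... | full all    = ℕP.≤-trans (E.reach-full ia all ia′) (ℕP.m≤n⇒m≤1+n (E.lower ia))
      ... | switched S  = ℕP.≤-trans (E.reach-unselected ia S ia′ sa′)
                                     (ℕP.≤-trans (ℕP.≤-reflexive (ℕP.+-suc (E.dc ia) 1)) (s≤s (E.lower ia)))

      profile : Flat i u ⊎ ∃ (Step i j u)
      profile with count (isA i) in cA
      ... | zero  = inj₁ λ a _ ia _ → contradiction (trans (count-remove (isA i) a (IsA⇒isA ia)) cA) λ ()
      ... | suc _ with count-nonempty (isA i) (subst (0 <_) (sym cA) (s≤s z≤n))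
      ...   | a₀ , ia₀ with selected-nonempty j (isA⇒IsA ia₀) | unselected-nonempty j (isA⇒IsA ia₀)
      ...     | s , ss | t , it , st = split (ℕP.m≤n⇒m<n∨m≡n (unselected≤selected+1 is it ss st))
        where
        is = sel-sub i j s ss
        halves : ∀ a → IsA i a → D u a ≡ (if sel i j a then D u s else D u t)
        halves a ia with sel i j a in sa
        ... | true  = ℕP.≤-antisym (selected-level is ia ss sa) (selected-level ia is sa ss)
        ... | false = ℕP.≤-antisym (unselected-level it ia st sa) (unselected-level ia it sa st)
        split : D u t < suc (D u s) ⊎ D u t ≡ suc (D u s) → Flat i u ⊎ ∃ (Step i j u)
        split (inj₁ Dut≤Dus) = inj₁ λ a a′ ia ia′ → trans (flat a ia) (sym (flat a′ ia′))
          where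
          equal : D u t ≡ D u s
          equal = ℕP.≤-antisym (ℕP.≤-pred Dut≤Dus) (selected≤unselected is it ss st)
          flat : ∀ a → IsA i a → D u a ≡ D u s
          flat a ia with sel i j a | halves a ia
          ... | true  | e = e
          ... | false | e = trans e equal
        split (inj₂ one-more) = inj₂ (D u s , stepped)
          where
          stepped : ∀ a → IsA i a → D u a ≡ D u s + ind (not (sel i j a))
          stepped a ia with sel i j a | halves a ia
          ... | true  | e = trans e (sym (ℕP.+-identityʳ _))
          ... | false | e = trans e (trans one-more (ℕP.+-comm 1 (D u s)))

      D′≤D-flat : Flat i u → ∀ {v} → IsA i v → D′ u v ≤ D u v
      D′≤D-flat flat {v} iv with E.kindᶜ iv
      ... | full all = ℕP.≤-trans (M′.D-stepʳ (E.D′uc iv) (keeps-full (E.c iv) i j (E.c∈B iv) all v iv)) (E.lower iv)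
      ... | switched S with sel i j v in sv
      ...   | false = ℕP.≤-trans (M′.D-stepʳ (E.D′uc iv) (switches (E.c iv) i j (E.c∈B iv) S v iv sv)) (E.lower iv)
      ...   | true with neighbour-in-unselected j iv sv
      ...     | a , ia , sa , va with E.kindᶜ ia
      ...       | full all = ℕP.≤-trans (M′.D-stepʳ (E.D′uc ia) (keeps-full (E.c ia) i j (E.c∈B ia) all v iv))
                                        (ℕP.≤-trans (E.lower ia) (ℕP.≤-reflexive (flat a v ia iv)))
      ...       | switched S′ = begin
        D′ u v          ≤⟨ M′.D-stepʳ (M′.D-stepʳ (E.D′uc ia) (switches (E.c ia) i j (E.c∈B ia) S′ a ia sa))
                                      (keeps-AA a v (i , ia) (i , iv) (trans (G-sym a v) va)) ⟩
        E.dc ia + 1 + 1 ≡⟨ ℕP.+-assoc (E.dc ia) 1 1 ⟩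
        E.dc ia + 2     ≤⟨ E.unselected-far ia S′ sa ⟩
        D u a           ≡⟨ flat a v ia iv ⟩
        D u v           ∎
        where open ℕP.≤-Reasoning

      D′≤-step : ∀ {f} → Step i j u f → ∀ {v} → IsA i v → D′ u v ≤ f + ind (sel i j v)
      D′≤-step {f} steps {v} iv with selected-nonempty j iv | unselected-nonempty j iv
      ... | s , ss | t , it , st = bound (E.kindᶜ is)
        where
        is = sel-sub i j s ss
        Dus : D u s ≡ f
        Dus = trans (steps s is) (trans (cong (λ b → f + ind (not b)) ss) (ℕP.+-identityʳ f))
        Dut : D u t ≡ f + 1
        Dut = trans (steps t it) (cong (λ b → f + ind (not b)) st)
        bound : ExitKind i j (E.c is) → D′ u v ≤ f + ind (sel i j v)
        bound (full all) = contradiction (begin-strict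
          f           ≡⟨ sym Dus ⟩
          D u s       <⟨ ℕP.≤-trans (ℕP.≤-reflexive (trans (ℕP.+-comm 1 (D u s)) (trans (cong (_+ 1) Dus) (sym Dut))))
                                    (E.reach-full is all it) ⟩
          E.dc is + 1 ≤⟨ E.lower is ⟩
          D u s       ≡⟨ Dus ⟩
          f           ∎) (ℕP.n≮n f)
          where open ℕP.≤-Reasoning
        bound (switched S) with sel i j v in sv
        ... | false = ℕP.≤-trans (M′.D-stepʳ (E.D′uc is) (switches (E.c is) i j (E.c∈B is) S v iv sv))
                                 (ℕP.≤-trans (E.lower is) (ℕP.≤-reflexive (trans Dus (sym (ℕP.+-identityʳ f)))))
        ... | true with neighbour-in-unselected j iv sv
        ...   | y , iy , sy , vy =
          ℕP.≤-trans (M′.D-stepʳ (M′.D-stepʳ (E.D′uc is) (switches (E.c is) i j (E.c∈B is) S y iy sy))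
                                 (keeps-AA y v (i , iy) (i , iv) (trans (G-sym y v) vy)))
                     (ℕP.+-monoˡ-≤ 1 (ℕP.≤-trans (E.lower is) (ℕP.≤-reflexive Dus)))

module Instance {n m : ℕ} {ℓ : Fin m → ℕ} (part : Fin n → Part m ℓ)
                (sel : (i : Fin m) → Fin (ℓ i) → Fin n → Bool) (G₁ : Adj n)
                (hyp : Construction.Hypotheses part sel G₁) where
  open import Data.Nat using (_+_; _*_; _≤_)
  import Data.Nat.Properties as ℕP
  open import Data.Nat.Divisibility using (_∣_)
  open import Data.Fin using (_≟_)
  open import Data.Bool using (true; false; _∧_; not; if_then_else_)
  open import Data.Bool.Properties using (∧-zeroʳ; not-involutive)
  open import Data.Product using (_×_; _,_; proj₁; proj₂)
  open import Data.Sum using (_⊎_; inj₁; inj₂)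
  open import Function using (_∘_)
  open import Relation.Nullary using (¬_; yes; no; contradiction)
  open import Relation.Binary.PropositionalEquality
  open Partition part
  open Counting
  module C = Construction part sel G₁
  open Construction.Hypotheses hyp

  G₂ : Adj n
  G₂ = C.G₂

  G₁-sym : ∀ u v → G₁ u v ≡ G₁ v u
  G₁-sym = proj₁ simple

  isA-agrees : ∀ i v → C.isA i v ≡ isA i v
  isA-agrees i v with part v
  ... | inA _   = refl
  ... | inB _ _ = refl

  SelectedNeighbourhood : Fin n → (i : Fin m) → Fin (ℓ i) → Set
  SelectedNeighbourhood c i j = ∀ w → IsA i w → G₁ c w ≡ sel i j w

  -- The predicate tested by allB in Construction.switched.
  matchesSel : Fin n → (i : Fin m) → Fin (ℓ i) → Fin n → Bool
  matchesSel c i j w = if C.isA i w then (if G₁ c w then sel i j w else not (sel i j w)) else true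

  matchesSel⇒≡ : ∀ {c i j w} → matchesSel c i j w ≡ true → IsA i w → G₁ c w ≡ sel i j w
  matchesSel⇒≡ {c} {i} {j} {w} e iw rewrite isA-agrees i w | IsA⇒isA iw with G₁ c w | sel i j w
  ... | true  | true  = refl
  ... | false | false = refl

  ≡⇒matchesSel : ∀ {c i j} → SelectedNeighbourhood c i j → ∀ w → matchesSel c i j w ≡ true
  ≡⇒matchesSel {c} {i} {j} S w rewrite isA-agrees i w with isA i w in e
  ... | false = refl
  ... | true rewrite S w (isA⇒IsA e) with sel i j w
  ...   | true  = refl
  ...   | false = refl

  affected-A : ∀ {u v k} → IsA k u → C.affected u v ≡ false
  affected-A au rewrite au = refl

  switched-B : ∀ {u i j} → IsB i j u → C.switched u ≡ allB (matchesSel u i j)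
  switched-B bu rewrite bu = refl

  affected-B : ∀ {u v i j} → IsB i j u → C.affected u v ≡ allB (matchesSel u i j) ∧ C.isA i v
  affected-B {v = v} {i} bu rewrite bu = cong (_∧ C.isA i v) (switched-B bu)

  affected-B-other : ∀ {u v i j} → IsB i j u → ¬ IsA i v → C.affected u v ≡ false
  affected-B-other {u} {v} {i} {j} bu ¬iv =
    trans (affected-B bu) (trans (cong (allB (matchesSel u i j) ∧_) (trans (isA-agrees i v) (¬IsA⇒isA ¬iv))) (∧-zeroʳ _))

  newEdge-B : ∀ {u v i j} → IsB i j u → C.newEdge u v ≡ not (sel i j v)
  newEdge-B bu rewrite bu = refl

  G₂-unaffected : ∀ {u v} → C.affected u v ≡ false → C.affected v u ≡ false → G₂ u v ≡ G₁ u v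
  G₂-unaffected uv vu rewrite uv | vu = refl

  G₂-AA : ∀ {u v k k′} → IsA k u → IsA k′ v → G₂ u v ≡ G₁ u v
  G₂-AA au av = G₂-unaffected (affected-A au) (affected-A av)

  G₂-BB : ∀ {u v i j i′ j′} → IsB i j u → IsB i′ j′ v → G₂ u v ≡ G₁ u v
  G₂-BB bu bv = G₂-unaffected (affected-B-other bu (λ iv → IsA⇒¬IsB iv bv)) (affected-B-other bv (λ iu → IsA⇒¬IsB iu bu))

  G₂-B-otherA : ∀ {c a i j k} → IsB i j c → IsA k a → ¬ k ≡ i → G₂ c a ≡ G₁ c a × G₂ a c ≡ G₁ a c
  G₂-B-otherA bc ak k≢i = G₂-unaffected ca (affected-A ak) , G₂-unaffected (affected-A ak) ca
    where ca = affected-B-other bc (λ ia → k≢i (IsA-unique ak ia))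

  data Switch (c : Fin n) (i : Fin m) (j : Fin (ℓ i)) : Set where
    switched   : SelectedNeighbourhood c i j →
                 (∀ a → IsA i a → G₂ c a ≡ not (sel i j a) × G₂ a c ≡ not (sel i j a)) → Switch c i j
    unswitched : ¬ SelectedNeighbourhood c i j →
                 (∀ a → IsA i a → G₂ c a ≡ G₁ c a × G₂ a c ≡ G₁ a c) → Switch c i j

  switch : ∀ {c i j} → IsB i j c → Switch c i j
  switch {c} {i} {j} bc with allB (matchesSel c i j) in sw
  ... | true  = switched (λ w iw → matchesSel⇒≡ (allB-true (matchesSel c i j) sw w) iw) new
    where
    affected : ∀ {a} → IsA i a → C.affected c a ≡ true
    affected {a} ia = trans (affected-B bc) (cong₂ _∧_ sw (trans (isA-agrees i a) (IsA⇒isA ia)))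
    new : ∀ a → IsA i a → G₂ c a ≡ not (sel i j a) × G₂ a c ≡ not (sel i j a)
    new a ia rewrite affected ia | affected-A {v = c} ia = newEdge-B bc , newEdge-B bc
  ... | false = unswitched (λ S → contradiction (trans (sym (allB-intro _ (≡⇒matchesSel S))) sw) λ ())
                           (λ a ia → G₂-unaffected (unaffected a) (affected-A ia) , G₂-unaffected (affected-A ia) (unaffected a))
    where
    unaffected : ∀ a → C.affected c a ≡ false
    unaffected a = trans (affected-B bc) (cong (_∧ C.isA i a) sw)

  G₂-B-A : ∀ {c a i j k} → IsB i j c → IsA k a → G₂ c a ≡ G₂ a c
  G₂-B-A {c} {a} {i} {j} {k} bc ak with k ≟ i
  ... | no k≢i = trans (proj₁ same) (trans (G₁-sym c a) (sym (proj₂ same)))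
    where same = G₂-B-otherA bc ak k≢i
  ... | yes refl with switch bc
  ...   | switched _ new   = trans (proj₁ (new a ak)) (sym (proj₂ (new a ak)))
  ...   | unswitched _ old = trans (proj₁ (old a ak)) (trans (G₁-sym c a) (sym (proj₂ (old a ak))))

  G₂-sym : ∀ u v → G₂ u v ≡ G₂ v u
  G₂-sym u v with kind u | kind v
  ... | kA _ au   | kA _ av   = trans (G₂-AA au av) (trans (G₁-sym u v) (sym (G₂-AA av au)))
  ... | kB _ _ bu | kB _ _ bv = trans (G₂-BB bu bv) (trans (G₁-sym u v) (sym (G₂-BB bv bu)))
  ... | kB _ _ bu | kA _ av   = G₂-B-A bu av
  ... | kA _ au   | kB _ _ bv = sym (G₂-B-A bv au)

  half : Fin m → ℕ
  half i = _∣_.quotient (A-even i)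

  size-A : ∀ i → count (isA i) ≡ half i + half i
  size-A i = begin
    count (isA i)      ≡⟨ count-cong (sym ∘ isA-agrees i) ⟩
    count (C.isA i)    ≡⟨ _∣_.equality (A-even i) ⟩
    half i * 2         ≡⟨ ℕP.*-comm (half i) 2 ⟩
    2 * half i         ≡⟨ cong (half i +_) (ℕP.+-identityʳ (half i)) ⟩
    half i + half i    ∎
    where open ≡-Reasoning

  size-sel : ∀ i j → count (sel i j) ≡ half i
  size-sel i j = ℕP.*-cancelˡ-≡ (count (sel i j)) (half i) 2
    (trans (sel-half i j) (trans (_∣_.equality (A-even i)) (ℕP.*-comm (half i) 2)))

  degree : Fin m → ℕ
  degree i = proj₁ (A-regular i)

  half≤degree : ∀ i → half i ≤ degree i
  half≤degree i = ℕP.*-cancelˡ-≤ 2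
    (ℕP.≤-trans (ℕP.≤-reflexive (sym (trans (_∣_.equality (A-even i)) (ℕP.*-comm (half i) 2))))
                (proj₁ (proj₂ (A-regular i))))

  regular₁ : ∀ i v → IsA i v → count (λ w → G₁ v w ∧ isA i w) ≡ degree i
  regular₁ i v iv = trans (count-cong (λ w → cong (G₁ v w ∧_) (sym (isA-agrees i w)))) (proj₂ (proj₂ (A-regular i)) v iv)

  module S₁ = Switching part sel

  structure₁ : S₁.BlockStructure G₁
  structure₁ = record
    { G-sym = G₁-sym ; G-irreflexive = proj₂ simple ; A-modules = A-modules ; B-B = B-B ; B-otherA = B-otherA
    ; B-A = B-A ; sel-sub = sel-sub ; half = half ; size-A = size-A ; size-sel = size-sel
    ; degree = degree ; half≤degree = half≤degree ; regular = regular₁ }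

  open S₁.Blocks structure₁ using (selected-nonempty; unselected-nonempty; count-unselected)

  switching₁₂ : S₁.IsSwitching G₁ G₂
  switching₁₂ = record
    { structure = structure₁
    ; G′-sym = G₂-sym
    ; keeps-AA = λ u v au av e → trans (G₂-AA (proj₂ au) (proj₂ av)) e
    ; keeps-BB = λ u v i j bu bv e → trans (G₂-BB bu bv) e
    ; keeps-full = keeps-full
    ; switches = switches
    }
    where
    keeps-full : ∀ c i j → IsB i j c → (∀ w → IsA i w → G₁ c w ≡ true) → ∀ a → IsA i a → G₂ c a ≡ true
    keeps-full c i j bc full a ia with switch bc
    ... | unswitched _ old = trans (proj₁ (old a ia)) (full a ia)
    ... | switched S _ with unselected-nonempty j ia
    ...   | w , iw , sw with () ← trans (sym (trans (sym (S w iw)) (full w iw))) sw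
    switches : ∀ c i j → IsB i j c → SelectedNeighbourhood c i j → ∀ a → IsA i a → sel i j a ≡ false → G₂ c a ≡ true
    switches c i j bc S a ia sa with switch bc
    ... | switched _ new  = trans (proj₁ (new a ia)) (cong not sa)
    ... | unswitched ¬S _ = contradiction S ¬S

  -- G₁ arises from G₂ by the same switching with the complementary halves.
  sel₂ : (i : Fin m) → Fin (ℓ i) → Fin n → Bool
  sel₂ i j w = isA i w ∧ not (sel i j w)

  sel₂-A : ∀ {i j w} → IsA i w → sel₂ i j w ≡ not (sel i j w)
  sel₂-A iw rewrite IsA⇒isA iw = refl

  module S₂ = Switching part sel₂

  structure₂ : S₂.BlockStructure G₂
  structure₂ = record
    { G-sym = G₂-sym
    ; G-irreflexive = irreflexive
    ; A-modules = modules
    ; B-B = λ u v i j i′ j′ bu bv ne → trans (G₂-BB bu bv) (B-B u v i j i′ j′ bu bv ne)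
    ; B-otherA = λ u v i j i′ bu av ne → trans (proj₁ (G₂-B-otherA bu av (ne ∘ sym))) (B-otherA u v i j i′ bu av ne)
    ; B-A = attachment
    ; sel-sub = λ i j v e → isA⇒IsA (proj₁ (∧-true e))
    ; half = half ; size-A = size-A ; size-sel = count-unselected
    ; degree = degree ; half≤degree = half≤degree
    ; regular = λ i v iv → trans (count-cong (same-degree i v iv)) (regular₁ i v iv)
    }
    where
    irreflexive : ∀ v → G₂ v v ≡ false
    irreflexive v with kind v
    ... | kA _ av   = trans (G₂-AA av av) (proj₂ simple v)
    ... | kB _ _ bv = trans (G₂-BB bv bv) (proj₂ simple v)
    modules : ∀ i k → ¬ i ≡ k → ∀ v → IsA i v →
              (∀ w → IsA k w → G₂ v w ≡ true) ⊎ (∀ w → IsA k w → G₂ v w ≡ false)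
    modules i k i≢k v iv with A-modules i k i≢k v iv
    ... | inj₁ all  = inj₁ λ w kw → trans (G₂-AA iv kw) (all w kw)
    ... | inj₂ none = inj₂ λ w kw → trans (G₂-AA iv kw) (none w kw)
    same-degree : ∀ i v → IsA i v → ∀ w → G₂ v w ∧ isA i w ≡ G₁ v w ∧ isA i w
    same-degree i v iv w with isA i w in e
    ... | true  = cong (_∧ true) (G₂-AA iv (isA⇒IsA e))
    ... | false = trans (∧-zeroʳ _) (sym (∧-zeroʳ _))
    attachment : ∀ b i j → IsB i j b → (∀ w → IsA i w → G₂ b w ≡ false) ⊎
                 (∀ w → IsA i w → G₂ b w ≡ true) ⊎ (∀ w → IsA i w → G₂ b w ≡ sel₂ i j w)
    attachment b i j bb with switch bb
    ... | switched _ new = inj₂ (inj₂ λ w iw → trans (proj₁ (new w iw)) (sym (sel₂-A iw)))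
    ... | unswitched ¬S old with B-A b i j bb
    ...   | inj₁ none        = inj₁ λ w iw → trans (proj₁ (old w iw)) (none w iw)
    ...   | inj₂ (inj₁ full) = inj₂ (inj₁ λ w iw → trans (proj₁ (old w iw)) (full w iw))
    ...   | inj₂ (inj₂ S)    = contradiction S ¬S

  switching₂₁ : S₂.IsSwitching G₂ G₁
  switching₂₁ = record
    { structure = structure₂
    ; G′-sym = G₁-sym
    ; keeps-AA = λ u v au av e → trans (sym (G₂-AA (proj₂ au) (proj₂ av))) e
    ; keeps-BB = λ u v i j bu bv e → trans (sym (G₂-BB bu bv)) e
    ; keeps-full = keeps-full
    ; switches = switches
    }
    where
    keeps-full : ∀ c i j → IsB i j c → (∀ w → IsA i w → G₂ c w ≡ true) → ∀ a → IsA i a → G₁ c a ≡ true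
    keeps-full c i j bc full a ia with switch bc
    ... | unswitched _ old = trans (sym (proj₁ (old a ia))) (full a ia)
    ... | switched _ new with selected-nonempty j ia
    ...   | w , sw with () ← trans (sym (full w (sel-sub i j w sw))) (trans (proj₁ (new w (sel-sub i j w sw))) (cong not sw))
    switches : ∀ c i j → IsB i j c → (∀ w → IsA i w → G₂ c w ≡ sel₂ i j w) →
               ∀ a → IsA i a → sel₂ i j a ≡ false → G₁ c a ≡ true
    switches c i j bc S₂ a ia s₂a with switch bc
    ... | switched S _ = trans (S a ia) (trans (sym (not-involutive _)) (cong not (trans (sym (sel₂-A ia)) s₂a)))
    ... | unswitched ¬S old with B-A c i j bc
    ...   | inj₂ (inj₁ full) = full a ia
    ...   | inj₂ (inj₂ S)    = contradiction S ¬S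
    ...   | inj₁ none with unselected-nonempty j ia
    ...     | w , iw , sw with () ← trans (sym (none w iw))
                                      (trans (sym (proj₁ (old w iw))) (trans (S₂ w iw) (trans (sel₂-A iw) (cong not sw))))

module Distances {n m : ℕ} {ℓ : Fin m → ℕ} (part : Fin n → Part m ℓ)
                 (sel : (i : Fin m) → Fin (ℓ i) → Fin n → Bool) (G₁ : Adj n)
                 (hyp : Construction.Hypotheses part sel G₁)
                 (D₁ D₂ : Fin n → Fin n → ℕ) (isD₁ : IsDistanceMatrix G₁ D₁)
                 (isD₂ : IsDistanceMatrix (Construction.G₂ part sel G₁) D₂) where
  open import Data.Nat using (_+_; _≤_; _<_)
  import Data.Nat.Properties as ℕP
  open import Data.Bool using (not)
  open import Data.Bool.Properties using (not-involutive)
  open import Data.Product using (_,_)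
  open import Data.Sum using (inj₁; inj₂)
  open import Relation.Nullary using (¬_; contradiction)
  open import Relation.Binary.PropositionalEquality
  open Partition part
  open Counting using (ind)
  open Instance part sel G₁ hyp
  open Construction.Hypotheses hyp using (sel-sub)
  open S₁.Blocks structure₁ using (selected-nonempty; unselected-nonempty)
  module D₂≤D₁ = S₁.Comparison switching₁₂ D₁ D₂ isD₁ isD₂
  module D₁≤D₂ = S₂.Comparison switching₂₁ D₂ D₁ isD₂ isD₁
  module M₁ = Distance.Metric G₁ G₁-sym D₁ isD₁
  module M₂ = Distance.Metric G₂ G₂-sym D₂ isD₂

  D₁≡D₂-AA : ∀ {u v} → AnyA u → AnyA v → D₁ u v ≡ D₂ u v
  D₁≡D₂-AA au av = ℕP.≤-antisym (D₁≤D₂.D′≤D-AA au av) (D₂≤D₁.D′≤D-AA au av)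

  D₁≡D₂-B-otherA : ∀ {i j k u v} → IsB i j u → IsA k v → ¬ k ≡ i → D₁ u v ≡ D₂ u v
  D₁≡D₂-B-otherA bu av k≢i = ℕP.≤-antisym (D₁≤D₂.D′≤D-B-otherA bu av k≢i) (D₂≤D₁.D′≤D-B-otherA bu av k≢i)

  D₁≡D₂-BB : ∀ {i j k j′ u v} → IsB i j u → IsB k j′ v → D₁ u v ≡ D₂ u v
  D₁≡D₂-BB bu bv = ℕP.≤-antisym (D₁≤D₂.D′≤D-BB bu bv) (D₂≤D₁.D′≤D-BB bu bv)

  data BProfile (i : Fin m) (j : Fin (ℓ i)) (u : Fin n) : Set where
    flat    : (∀ a a′ → IsA i a → IsA i a′ → D₁ u a ≡ D₁ u a′) → (∀ a → IsA i a → D₂ u a ≡ D₁ u a) →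
              BProfile i j u
    swapped : ∀ f → (∀ a → IsA i a → D₁ u a ≡ f + ind (not (sel i j a))) →
              (∀ a → IsA i a → D₂ u a ≡ f + ind (sel i j a)) → BProfile i j u

  module _ {i j u} (bu : IsB i j u) where

    step-in-G₂ : ∀ {g} → D₁≤D₂.Step i j u g → ∀ a → IsA i a → D₂ u a ≡ g + ind (sel i j a)
    step-in-G₂ {g} step₂ a ia = trans (step₂ a ia) (trans (cong (λ b → g + ind (not b)) (sel₂-A ia))
                                                          (cong (λ b → g + ind b) (not-involutive (sel i j a))))

    flat-then-step : D₂≤D₁.Flat i u → ∀ {g} → D₁≤D₂.Step i j u g → ∀ {a} → ¬ IsA i a
    flat-then-step flat₁ {g} step₂ ia with selected-nonempty j ia
    ... | s , ss = ℕP.n≮n g (begin-strict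
      g                     <⟨ ℕP.≤-reflexive (ℕP.+-comm 1 g) ⟩
      g + 1                 ≡⟨ cong (λ b → g + ind b) (sym ss) ⟩
      g + ind (sel i j s)   ≡⟨ sym (step-in-G₂ step₂ s is) ⟩
      D₂ u s                ≤⟨ D₂≤D₁.D′≤D-flat bu flat₁ is ⟩
      D₁ u s                ≤⟨ D₁≤D₂.D′≤-step bu step₂ is ⟩
      g + ind (sel₂ i j s)  ≡⟨ cong (λ b → g + ind b) (trans (sel₂-A is) (cong not ss)) ⟩
      g + 0                 ≡⟨ ℕP.+-identityʳ g ⟩
      g                     ∎)
      where open ℕP.≤-Reasoning
            is = sel-sub i j s ss

    step-then-flat : ∀ {f} → D₂≤D₁.Step i j u f → D₁≤D₂.Flat i u → ∀ {a} → ¬ IsA i a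
    step-then-flat {f} step₁ flat₂ ia with unselected-nonempty j ia
    ... | t , it , st = ℕP.n≮n f (begin-strict
      f                          <⟨ ℕP.≤-reflexive (ℕP.+-comm 1 f) ⟩
      f + 1                      ≡⟨ cong (λ b → f + ind (not b)) (sym st) ⟩
      f + ind (not (sel i j t))  ≡⟨ sym (step₁ t it) ⟩
      D₁ u t                     ≤⟨ D₁≤D₂.D′≤D-flat bu flat₂ it ⟩
      D₂ u t                     ≤⟨ D₂≤D₁.D′≤-step bu step₁ it ⟩
      f + ind (sel i j t)        ≡⟨ cong (λ b → f + ind b) st ⟩
      f + 0                      ≡⟨ ℕP.+-identityʳ f ⟩
      f                          ∎)
      where open ℕP.≤-Reasoning

    steps-agree : ∀ {f g} → D₂≤D₁.Step i j u f → D₁≤D₂.Step i j u g → ∀ {a} → IsA i a → g ≡ f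
    steps-agree {f} {g} step₁ step₂ ia with selected-nonempty j ia | unselected-nonempty j ia
    ... | s , ss | t , it , st = ℕP.≤-antisym g≤f f≤g
      where
      open ℕP.≤-Reasoning
      is = sel-sub i j s ss
      g≤f : g ≤ f
      g≤f = begin
        g                      ≡⟨ sym (ℕP.+-identityʳ g) ⟩
        g + 0                  ≡⟨ cong (λ b → g + ind b) (sym st) ⟩
        g + ind (sel i j t)    ≡⟨ sym (step-in-G₂ step₂ t it) ⟩
        D₂ u t                 ≤⟨ D₂≤D₁.D′≤-step bu step₁ it ⟩
        f + ind (sel i j t)    ≡⟨ cong (λ b → f + ind b) st ⟩
        f + 0                  ≡⟨ ℕP.+-identityʳ f ⟩
        f                      ∎
      f≤g : f ≤ g
      f≤g = begin
        f                          ≡⟨ sym (ℕP.+-identityʳ f) ⟩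
        f + 0                      ≡⟨ cong (λ b → f + ind (not b)) (sym ss) ⟩
        f + ind (not (sel i j s))  ≡⟨ sym (step₁ s is) ⟩
        D₁ u s                     ≤⟨ D₁≤D₂.D′≤-step bu step₂ is ⟩
        g + ind (sel₂ i j s)       ≡⟨ cong (λ b → g + ind b) (trans (sel₂-A is) (cong not ss)) ⟩
        g + 0                      ≡⟨ ℕP.+-identityʳ g ⟩
        g                          ∎

    B-profile : BProfile i j u
    B-profile with D₂≤D₁.profile bu | D₁≤D₂.profile bu
    ... | inj₁ flat₁       | inj₁ flat₂       =
      flat flat₁ λ a ia → ℕP.≤-antisym (D₂≤D₁.D′≤D-flat bu flat₁ ia) (D₁≤D₂.D′≤D-flat bu flat₂ ia)
    ... | inj₁ flat₁       | inj₂ (g , step₂) = flat flat₁ λ a ia → contradiction ia (flat-then-step flat₁ step₂)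
    ... | inj₂ (f , step₁) | inj₁ flat₂       = swapped f step₁ λ a ia → contradiction ia (step-then-flat step₁ flat₂)
    ... | inj₂ (f , step₁) | inj₂ (g , step₂) =
      swapped f step₁ λ a ia → trans (step-in-G₂ step₂ a ia) (cong (_+ ind (sel i j a)) (steps-agree step₁ step₂ ia))

module SubsetSums where
  open import Data.Nat using (zero; suc)
  open import Data.Fin using (zero; suc)
  open import Data.Integer using (ℤ; +_; _+_; _*_)
  import Data.Integer.Properties as ℤP
  open import Data.Bool using (true; false; _∧_)
  open import Relation.Binary.PropositionalEquality
  open import Data.Integer.Tactic.RingSolver using (solve-∀)
  open Sums
  open Counting using (ind)

  𝟙 : Bool → ℤ
  𝟙 b = + ind b

  sumOver : ∀ {n} → (Fin n → Bool) → (Fin n → ℤ) → ℤ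
  sumOver b X = sumFin (λ w → 𝟙 (b w) * X w)

  sumOver-cong : ∀ {n} (b : Fin n → Bool) {X Y : Fin n → ℤ} → (∀ w → b w ≡ true → X w ≡ Y w) →
                 sumOver b X ≡ sumOver b Y
  sumOver-cong b {X} {Y} X≡Y = sumFin-cong λ w → on (b w) refl
    where
    on : ∀ {w} c → b w ≡ c → 𝟙 (b w) * X w ≡ 𝟙 (b w) * Y w
    on {w} true  bw = cong (𝟙 (b w) *_) (X≡Y w bw)
    on     false bw rewrite bw = refl

  sumFin-𝟙 : ∀ {n} (b : Fin n → Bool) → sumFin (λ w → 𝟙 (b w)) ≡ + count b
  sumFin-𝟙 {zero}  b = refl
  sumFin-𝟙 {suc n} b = trans (cong (_+_ (𝟙 (b zero))) (sumFin-𝟙 (λ w → b (suc w)))) (sym (ℤP.pos-+ (ind (b zero)) _))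

  sumOver-const : ∀ {n} (b : Fin n → Bool) {X : Fin n → ℤ} x → (∀ w → b w ≡ true → X w ≡ x) →
                  sumOver b X ≡ + count b * x
  sumOver-const b {X} x X≡x = begin
    sumOver b X               ≡⟨ sumOver-cong b X≡x ⟩
    sumFin (λ w → 𝟙 (b w) * x) ≡⟨ sumFin-*ʳ x (λ w → 𝟙 (b w)) ⟩
    sumFin (λ w → 𝟙 (b w)) * x ≡⟨ cong (_* x) (sumFin-𝟙 b) ⟩
    + count b * x             ∎
    where open ≡-Reasoning

  sumOver-+ : ∀ {n} (b : Fin n → Bool) (X Y : Fin n → ℤ) → sumOver b (λ w → X w + Y w) ≡ sumOver b X + sumOver b Y
  sumOver-+ b X Y = trans (sumFin-cong (λ w → ℤP.*-distribˡ-+ (𝟙 (b w)) (X w) (Y w)))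
                          (sumFin-+ (λ w → 𝟙 (b w) * X w) (λ w → 𝟙 (b w) * Y w))

  sumOver-* : ∀ {n} (b : Fin n → Bool) a (X : Fin n → ℤ) → sumOver b (λ w → a * X w) ≡ a * sumOver b X
  sumOver-* b a X = trans (sumFin-cong (λ w → swap (𝟙 (b w)) a (X w))) (sumFin-*ˡ a (λ w → 𝟙 (b w) * X w))
    where
    swap : ∀ x y z → x * (y * z) ≡ y * (x * z)
    swap = solve-∀

  sumOver-𝟙 : ∀ {n} (b c : Fin n → Bool) → sumOver b (λ w → 𝟙 (c w)) ≡ + count (λ w → b w ∧ c w)
  sumOver-𝟙 b c = trans (sumFin-cong (λ w → 𝟙-∧ (b w) (c w))) (sumFin-𝟙 (λ w → b w ∧ c w))
    where
    𝟙-∧ : ∀ x y → 𝟙 x * 𝟙 y ≡ 𝟙 (x ∧ y)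
    𝟙-∧ true  true  = refl
    𝟙-∧ true  false = refl
    𝟙-∧ false _     = refl

module Scaling where
  open import Data.Nat using (zero; suc; _*_)
  open import Data.Fin using (zero; suc)
  import Data.Nat.Properties as ℕP
  open import Data.Vec.Functional using (removeAt)
  open import Data.Sum using (inj₂)
  open import Function using (_∘_)
  open import Relation.Nullary using (¬_)
  open import Relation.Binary.PropositionalEquality
  open import Algebra.Properties.CommutativeMonoid.Sum ℕP.*-1-commutativeMonoid
    using () renaming (sum to product; sum-remove to product-remove)

  cofactor : ∀ {m} → (Fin m → ℕ) → Fin m → ℕ
  cofactor {suc m} t i = product (removeAt t i)

  cofactor-* : ∀ {m} (t : Fin m → ℕ) i → cofactor t i * t i ≡ product t
  cofactor-* {suc m} t i = trans (ℕP.*-comm (cofactor t i) (t i)) (sym (product-remove t))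

  product-suc≢0 : ∀ {m} (f : Fin m → ℕ) → ¬ product (λ i → suc (f i)) ≡ 0
  product-suc≢0 {zero}  f ()
  product-suc≢0 {suc m} f e with ℕP.m*n≡0⇒m≡0∨n≡0 (suc (f zero)) e
  ... | inj₂ e′ = product-suc≢0 (f ∘ suc) e′

module SwitchingMatrix {n m : ℕ} {ℓ : Fin m → ℕ} (part : Fin n → Part m ℓ)
                       (sel : (i : Fin m) → Fin (ℓ i) → Fin n → Bool) (G₁ : Adj n)
                       (hyp : Construction.Hypotheses part sel G₁)
                       (D₁ D₂ : Fin n → Fin n → ℕ) (isD₁ : IsDistanceMatrix G₁ D₁)
                       (isD₂ : IsDistanceMatrix (Construction.G₂ part sel G₁) D₂) where
  open import Data.Nat as ℕ using (suc; _∸_)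
  import Data.Nat.Properties as ℕP
  open import Data.Integer using (ℤ; +_; -_; _+_; _*_; 0ℤ; 1ℤ)
  import Data.Integer.Properties as ℤP
  open import Data.Fin using (_≟_)
  open import Data.Bool using (true; false; _∧_; not)
  open import Data.Bool.Properties using (∧-comm)
  open import Data.Product using (_×_; _,_; proj₁; proj₂)
  open import Function using (_∘_)
  open import Relation.Nullary using (¬_; yes; no; Dec)
  open import Relation.Binary.PropositionalEquality
  open import Data.Integer.Tactic.RingSolver using (solve-∀)
  open Partition part
  open Counting using (ind; count-cong)
  open Sums
  open SubsetSums
  open Scaling
  open import Algebra.Properties.CommutativeMonoid.Sum ℕP.*-1-commutativeMonoid using () renaming (sum to product)
  open Determinant using (Mat)
  open Distances part sel G₁ hyp D₁ D₂ isD₁ isD₂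
  open Instance part sel G₁ hyp using (half; size-A; size-sel; degree; regular₁; structure₁; module S₁)
  open S₁.Blocks structure₁ using (count-unselected; isA∧sel; half-pos)

  sumA : Fin m → (Fin n → ℤ) → ℤ
  sumA i = sumOver (isA i)

  hℤ : Fin m → ℤ
  hℤ i = + half i

  count-Aℤ : ∀ i → + count (isA i) ≡ hℤ i + hℤ i
  count-Aℤ i = trans (cong +_ (size-A i)) (ℤP.pos-+ (half i) (half i))

  sumA-const : ∀ i {X : Fin n → ℤ} x → (∀ w → IsA i w → X w ≡ x) → sumA i X ≡ (hℤ i + hℤ i) * x
  sumA-const i x X≡x = trans (sumOver-const (isA i) x (λ w → X≡x w ∘ isA⇒IsA)) (cong (_* x) (count-Aℤ i))

  sumA-step : ∀ i (b : Fin n → Bool) {X : Fin n → ℤ} f → count (λ w → isA i w ∧ b w) ≡ half i →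
              (∀ w → IsA i w → X w ≡ + (f ℕ.+ ind (b w))) → sumA i X ≡ (hℤ i + hℤ i) * + f + hℤ i
  sumA-step i b {X} f half-b X≡ = begin
    sumA i X                                     ≡⟨ sumOver-cong (isA i) (λ w aw → trans (X≡ w (isA⇒IsA aw)) (ℤP.pos-+ f _)) ⟩
    sumA i (λ w → + f + 𝟙 (b w))                 ≡⟨ sumOver-+ (isA i) (λ _ → + f) (λ w → 𝟙 (b w)) ⟩
    sumA i (λ _ → + f) + sumA i (λ w → 𝟙 (b w))  ≡⟨ cong₂ _+_ (sumA-const i (+ f) (λ _ _ → refl))
                                                              (trans (sumOver-𝟙 (isA i) b) (cong +_ half-b)) ⟩
    (hℤ i + hℤ i) * + f + hℤ i                   ∎
    where open ≡-Reasoning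

  RowSums : Fin m → Fin n → Fin n → Set
  RowSums k u v = hℤ k * (+ D₁ u v + + D₂ u v) ≡ sumA k (λ w → + D₁ u w) ×
                  sumA k (λ w → + D₂ u w) ≡ sumA k (λ w → + D₁ u w)

  flat-rowSums : ∀ {k u v} → IsA k v → (∀ w → IsA k w → D₁ u w ≡ D₁ u v) → (∀ w → IsA k w → D₂ u w ≡ D₁ u w) →
                 RowSums k u v
  flat-rowSums {k} {u} {v} kv const same =
    trans (cong (λ d → hℤ k * (+ D₁ u v + + d)) (same v kv))
          (trans (double (hℤ k) (+ D₁ u v)) (sym (sumA-const k (+ D₁ u v) (λ w kw → cong +_ (const w kw))))) ,
    sumOver-cong (isA k) (λ w kw → cong +_ (same w (isA⇒IsA kw)))
    where
    double : ∀ a b → a * (b + b) ≡ (a + a) * b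
    double = solve-∀

  B-rowSums : ∀ {i j k u v} → IsB i j u → IsA k v → RowSums k u v
  B-rowSums {i} {j} {k} {u} {v} bu kv with k ≟ i
  ... | no k≢i = flat-rowSums kv
      (λ w kw → trans (M₁.D-sym u w) (trans (D₂≤D₁.A-equidistant (IsB⇒¬InBlock bu (k≢i ∘ sym)) kw kv) (M₁.D-sym v u)))
      (λ w kw → sym (D₁≡D₂-B-otherA bu kw k≢i))
  ... | yes refl with B-profile bu
  ...   | flat const same = flat-rowSums kv (λ w kw → const w v kw kv) same
  ...   | swapped f D₁≡ D₂≡ = trans (cong (hℤ k *_) pair) (trans (spread (hℤ k) (+ f)) (sym sum₁)) , trans sum₂ (sym sum₁)
    where
    sum₁ : sumA k (λ w → + D₁ u w) ≡ (hℤ k + hℤ k) * + f + hℤ k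
    sum₁ = sumA-step k (λ w → not (sel k j w)) f (count-unselected k j) (λ w kw → cong +_ (D₁≡ w kw))
    sum₂ : sumA k (λ w → + D₂ u w) ≡ (hℤ k + hℤ k) * + f + hℤ k
    sum₂ = sumA-step k (sel k j) f (trans (count-cong (isA∧sel k j)) (size-sel k j)) (λ w kw → cong +_ (D₂≡ w kw))
    pair : + D₁ u v + + D₂ u v ≡ + f + + f + 1ℤ
    pair rewrite D₁≡ v kv | D₂≡ v kv with sel k j v
    ... | true  = trans (cong₂ _+_ (ℤP.pos-+ f 0) (ℤP.pos-+ f 1)) (shuffle₀ (+ f))
      where
      shuffle₀ : ∀ x → x + 0ℤ + (x + 1ℤ) ≡ x + x + 1ℤ
      shuffle₀ = solve-∀
    ... | false = trans (cong₂ _+_ (ℤP.pos-+ f 1) (ℤP.pos-+ f 0)) (shuffle₁ (+ f))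
      where
      shuffle₁ : ∀ x → x + 1ℤ + (x + 0ℤ) ≡ x + x + 1ℤ
      shuffle₁ = solve-∀
    spread : ∀ a b → a * (b + b + 1ℤ) ≡ (a + a) * b + a
    spread = solve-∀

  A-distance : ∀ {i x w} → IsA i x → IsA i w → + D₁ x w ≡ + 2 + (- 1ℤ * 𝟙 (G₁ x w) + - + 2 * δ w x)
  A-distance {i} {x} {w} ix iw with w ≟ x
  ... | yes refl rewrite M₁.D-refl x | proj₂ (Construction.Hypotheses.simple hyp) x = refl
  ... | no w≢x with G₁ x w in e
  ...   | true  rewrite ℕP.≤-antisym (M₁.D-edge e) (M₁.D≢0 (w≢x ∘ sym)) = refl
  ...   | false rewrite ℕP.≤-antisym (D₂≤D₁.A-diameter ix iw) (M₁.non-edge⇒D≥2 (w≢x ∘ sym) e) = refl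

  A-rowSum : Fin m → ℤ
  A-rowSum i = (hℤ i + hℤ i) * + 2 + (- 1ℤ * + degree i + - + 2 * 1ℤ)

  -- Distances inside A^i are 0, 1 or 2, so regularity makes the row sums over A^i constant.
  sumA-A : ∀ {i x} → IsA i x → sumA i (λ w → + D₁ x w) ≡ A-rowSum i
  sumA-A {i} {x} ix = begin
    sumA i (λ w → + D₁ x w)
      ≡⟨ sumOver-cong (isA i) (λ w aw → A-distance ix (isA⇒IsA aw)) ⟩
    sumA i (λ w → + 2 + (- 1ℤ * 𝟙 (G₁ x w) + - + 2 * δ w x))
      ≡⟨ trans (sumOver-+ (isA i) _ _) (cong (_+_ (sumA i (λ _ → + 2))) (sumOver-+ (isA i) _ _)) ⟩
    sumA i (λ _ → + 2) + (sumA i (λ w → - 1ℤ * 𝟙 (G₁ x w)) + sumA i (λ w → - + 2 * δ w x))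
      ≡⟨ cong₂ _+_ (sumA-const i (+ 2) (λ _ _ → refl))
                   (cong₂ _+_ (trans (sumOver-* (isA i) (- 1ℤ) _) (cong (- 1ℤ *_) degree-sum))
                              (trans (sumOver-* (isA i) (- + 2) _) (cong (- + 2 *_) self-sum))) ⟩
    A-rowSum i ∎
    where
    open ≡-Reasoning
    degree-sum : sumA i (λ w → 𝟙 (G₁ x w)) ≡ + degree i
    degree-sum = trans (sumOver-𝟙 (isA i) (G₁ x))
                       (cong +_ (trans (count-cong (λ w → ∧-comm (isA i w) (G₁ x w))) (regular₁ i x ix)))
    self-sum : sumA i (λ w → δ w x) ≡ 1ℤ
    self-sum = trans (sumFin-δʳ x (λ w → 𝟙 (isA i w))) (cong 𝟙 (IsA⇒isA ix))

  -- H = ∏ᵢ max(1, half i) is divisible by every half i with A^i nonempty.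
  padded-half : Fin m → ℕ
  padded-half i = suc (half i ∸ 1)

  H : ℤ
  H = + product padded-half

  c : Fin m → ℤ
  c i = + cofactor padded-half i

  c*h≡H : ∀ {i a} → IsA i a → c i * hℤ i ≡ H
  c*h≡H {i} ia = trans (sym (ℤP.pos-* (cofactor padded-half i) (half i)))
                       (cong +_ (trans (cong (cofactor padded-half i ℕ.*_) (sym padded)) (cofactor-* padded-half i)))
    where
    padded : padded-half i ≡ half i
    padded with half i | half-pos ia
    ... | suc _ | _ = refl

  H≢0 : ¬ H ≡ 0ℤ
  H≢0 H≡0 = product-suc≢0 (λ i → half i ∸ 1) (ℤP.+-injective H≡0)

  sameA : Fin n → Fin n → Bool
  sameA u w with part u
  ... | inA i   = isA i w
  ... | inB _ _ = false

  weight : Fin n → ℤ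
  weight u with part u
  ... | inA i   = c i
  ... | inB _ _ = 0ℤ

  diagonal : Fin n → ℤ
  diagonal u with part u
  ... | inA _   = - H
  ... | inB _ _ = H

  -- On each block A^i this is H ((1 / half i) J − I), a multiple of an involution; it is H I on B.
  P : Mat n
  P u w = 𝟙 (sameA u w) * weight u + diagonal u * δ u w

  sameA-A : ∀ {i u} → IsA i u → ∀ w → sameA u w ≡ isA i w
  sameA-A iu w rewrite iu = refl

  sameA-B : ∀ {i j u} → IsB i j u → ∀ w → sameA u w ≡ false
  sameA-B bu w rewrite bu = refl

  weight-A : ∀ {i u} → IsA i u → weight u ≡ c i
  weight-A iu rewrite iu = refl

  weight-B : ∀ {i j u} → IsB i j u → weight u ≡ 0ℤ
  weight-B bu rewrite bu = refl

  diagonal-A : ∀ {i u} → IsA i u → diagonal u ≡ - H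
  diagonal-A iu rewrite iu = refl

  diagonal-B : ∀ {i j u} → IsB i j u → diagonal u ≡ H
  diagonal-B bu rewrite bu = refl

  sameA-weight-sym : ∀ w v → 𝟙 (sameA w v) * weight w ≡ 𝟙 (sameA v w) * weight v
  sameA-weight-sym w v with kind w | kind v
  ... | kA i wi | kA k vk with i ≟ k
  ...   | yes refl rewrite sameA-A wi v | sameA-A vk w | weight-A wi | weight-A vk | IsA⇒isA wi | IsA⇒isA vk = refl
  ...   | no i≢k rewrite sameA-A wi v | sameA-A vk w | ¬IsA⇒isA {i} {v} (λ iv → i≢k (IsA-unique iv vk))
                       | ¬IsA⇒isA {k} {w} (λ kw → i≢k (IsA-unique wi kw)) = refl
  sameA-weight-sym w v | kA i wi | kB k j vk rewrite sameA-A wi v | sameA-B vk w | ¬IsA⇒isA {i} {v} (λ iv → IsA⇒¬IsB iv vk) = refl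
  sameA-weight-sym w v | kB i j wi | kA k vk rewrite sameA-B wi v | sameA-A vk w | ¬IsA⇒isA {k} {w} (λ kw → IsA⇒¬IsB kw wi) = refl
  sameA-weight-sym w v | kB i j wi | kB k j′ vk rewrite sameA-B wi v | sameA-B vk w = refl

  row : ∀ u (X : Fin n → ℤ) → sumFin (λ w → P u w * X w) ≡ weight u * sumOver (sameA u) X + diagonal u * X u
  row u X = begin
    sumFin (λ w → P u w * X w)
      ≡⟨ sumFin-cong (λ w → spread (𝟙 (sameA u w)) (weight u) (diagonal u) (δ u w) (X w)) ⟩
    sumFin (λ w → weight u * (𝟙 (sameA u w) * X w) + diagonal u * (δ u w * X w))
      ≡⟨ sumFin-+ (λ w → weight u * (𝟙 (sameA u w) * X w)) (λ w → diagonal u * (δ u w * X w)) ⟩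
    sumFin (λ w → weight u * (𝟙 (sameA u w) * X w)) + sumFin (λ w → diagonal u * (δ u w * X w))
      ≡⟨ cong₂ _+_ (sumFin-*ˡ (weight u) (λ w → 𝟙 (sameA u w) * X w))
                   (trans (sumFin-*ˡ (diagonal u) (λ w → δ u w * X w)) (cong (diagonal u *_) (sumFin-δˡ u X))) ⟩
    weight u * sumOver (sameA u) X + diagonal u * X u ∎
    where
    open ≡-Reasoning
    spread : ∀ a b c d x → (a * b + c * d) * x ≡ b * (a * x) + c * (d * x)
    spread = solve-∀

  column : ∀ v (X : Fin n → ℤ) → sumFin (λ w → X w * P w v) ≡ weight v * sumOver (sameA v) X + X v * diagonal v
  column v X = begin
    sumFin (λ w → X w * P w v)
      ≡⟨ sumFin-cong (λ w → trans (cong (λ z → X w * (z + diagonal w * δ w v)) (sameA-weight-sym w v))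
                                  (spread (X w) (𝟙 (sameA v w)) (weight v) (diagonal w) (δ w v))) ⟩
    sumFin (λ w → weight v * (𝟙 (sameA v w) * X w) + (X w * diagonal w) * δ w v)
      ≡⟨ sumFin-+ (λ w → weight v * (𝟙 (sameA v w) * X w)) (λ w → (X w * diagonal w) * δ w v) ⟩
    sumFin (λ w → weight v * (𝟙 (sameA v w) * X w)) + sumFin (λ w → (X w * diagonal w) * δ w v)
      ≡⟨ cong₂ _+_ (sumFin-*ˡ (weight v) (λ w → 𝟙 (sameA v w) * X w)) (sumFin-δʳ v (λ w → X w * diagonal w)) ⟩
    weight v * sumOver (sameA v) X + X v * diagonal v ∎
    where
    open ≡-Reasoning
    spread : ∀ x a b c d → x * (a * b + c * d) ≡ b * (a * x) + (x * c) * d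
    spread = solve-∀

  row-B : ∀ {i j u} → IsB i j u → ∀ X → sumFin (λ w → P u w * X w) ≡ H * X u
  row-B {u = u} bu X = begin
    sumFin (λ w → P u w * X w)                          ≡⟨ row u X ⟩
    weight u * sumOver (sameA u) X + diagonal u * X u   ≡⟨ cong₂ (λ a d → a * sumOver (sameA u) X + d * X u) (weight-B bu) (diagonal-B bu) ⟩
    0ℤ * sumOver (sameA u) X + H * X u                  ≡⟨ ℤP.+-identityˡ (H * X u) ⟩
    H * X u                                             ∎
    where open ≡-Reasoning

  row-A : ∀ {i u} → IsA i u → ∀ X → sumFin (λ w → P u w * X w) ≡ c i * sumA i X + - H * X u
  row-A {i} {u} iu X = begin
    sumFin (λ w → P u w * X w)                          ≡⟨ row u X ⟩
    weight u * sumOver (sameA u) X + diagonal u * X u   ≡⟨ cong₂ (λ a d → a * sumOver (sameA u) X + d * X u) (weight-A iu) (diagonal-A iu) ⟩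
    c i * sumOver (sameA u) X + - H * X u               ≡⟨ cong (λ s → c i * s + - H * X u) (sumFin-cong (λ w → cong (λ b → 𝟙 b * X w) (sameA-A iu w))) ⟩
    c i * sumA i X + - H * X u                          ∎
    where open ≡-Reasoning

  column-B : ∀ {i j v} → IsB i j v → ∀ X → sumFin (λ w → X w * P w v) ≡ X v * H
  column-B {v = v} bv X = begin
    sumFin (λ w → X w * P w v)                          ≡⟨ column v X ⟩
    weight v * sumOver (sameA v) X + X v * diagonal v   ≡⟨ cong₂ (λ a d → a * sumOver (sameA v) X + X v * d) (weight-B bv) (diagonal-B bv) ⟩
    0ℤ * sumOver (sameA v) X + X v * H                  ≡⟨ ℤP.+-identityˡ (X v * H) ⟩
    X v * H                                             ∎
    where open ≡-Reasoning

  column-A : ∀ {k v} → IsA k v → ∀ X → sumFin (λ w → X w * P w v) ≡ c k * sumA k X + X v * - H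
  column-A {k} {v} kv X = begin
    sumFin (λ w → X w * P w v)                          ≡⟨ column v X ⟩
    weight v * sumOver (sameA v) X + X v * diagonal v   ≡⟨ cong₂ (λ a d → a * sumOver (sameA v) X + X v * d) (weight-A kv) (diagonal-A kv) ⟩
    c k * sumOver (sameA v) X + X v * - H               ≡⟨ cong (λ s → c k * s + X v * - H) (sumFin-cong (λ w → cong (λ b → 𝟙 b * X w) (sameA-A kv w))) ⟩
    c k * sumA k X + X v * - H                          ∎
    where open ≡-Reasoning

  sumA-column : ∀ {i k j u v} → IsA i u → IsB k j v → sumA i (λ w → + D₁ w v) ≡ hℤ i * (+ D₁ u v + + D₂ u v)
  sumA-column {i} {u = u} {v} iu bv = begin
    sumA i (λ w → + D₁ w v)          ≡⟨ sumOver-cong (isA i) (λ w _ → cong +_ (M₁.D-sym w v)) ⟩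
    sumA i (λ w → + D₁ v w)          ≡⟨ sym (proj₁ (B-rowSums bv iu)) ⟩
    hℤ i * (+ D₁ v u + + D₂ v u)     ≡⟨ cong₂ (λ a b → hℤ i * (+ a + + b)) (M₁.D-sym v u) (M₂.D-sym v u) ⟩
    hℤ i * (+ D₁ u v + + D₂ u v)     ∎
    where open ≡-Reasoning

  Intertwines : Fin n → Fin n → Set
  Intertwines u v = sumFin (λ w → P u w * + D₁ w v) ≡ sumFin (λ w → + D₂ u w * P w v)

  intertwine-BB : ∀ {i j k j′ u v} → IsB i j u → IsB k j′ v → Intertwines u v
  intertwine-BB {u = u} {v} bu bv = begin
    sumFin (λ w → P u w * + D₁ w v)   ≡⟨ row-B bu (λ w → + D₁ w v) ⟩
    H * + D₁ u v                      ≡⟨ cong (λ d → H * + d) (D₁≡D₂-BB bu bv) ⟩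
    H * + D₂ u v                      ≡⟨ ℤP.*-comm H (+ D₂ u v) ⟩
    + D₂ u v * H                      ≡⟨ sym (column-B bv (λ w → + D₂ u w)) ⟩
    sumFin (λ w → + D₂ u w * P w v)   ∎
    where open ≡-Reasoning

  intertwine-BA : ∀ {i j k u v} → IsB i j u → IsA k v → Intertwines u v
  intertwine-BA {k = k} {u} {v} bu kv = begin
    sumFin (λ w → P u w * + D₁ w v)                       ≡⟨ row-B bu (λ w → + D₁ w v) ⟩
    H * + D₁ u v                                          ≡⟨ cong (_* + D₁ u v) (sym (c*h≡H kv)) ⟩
    c k * hℤ k * + D₁ u v                                 ≡⟨ regroup (c k) (hℤ k) (+ D₁ u v) (+ D₂ u v) ⟩
    c k * (hℤ k * (+ D₁ u v + + D₂ u v)) + + D₂ u v * - (c k * hℤ k)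
      ≡⟨ cong₂ (λ s h → c k * s + + D₂ u v * - h) (trans (proj₁ sums) (sym (proj₂ sums))) (c*h≡H kv) ⟩
    c k * sumA k (λ w → + D₂ u w) + + D₂ u v * - H        ≡⟨ sym (column-A kv (λ w → + D₂ u w)) ⟩
    sumFin (λ w → + D₂ u w * P w v)                       ∎
    where
    open ≡-Reasoning
    sums = B-rowSums bu kv
    regroup : ∀ c h d₁ d₂ → c * h * d₁ ≡ c * (h * (d₁ + d₂)) + d₂ * - (c * h)
    regroup = solve-∀

  intertwine-AB : ∀ {i k j u v} → IsA i u → IsB k j v → Intertwines u v
  intertwine-AB {i} {u = u} {v} iu bv = begin
    sumFin (λ w → P u w * + D₁ w v)                       ≡⟨ row-A iu (λ w → + D₁ w v) ⟩
    c i * sumA i (λ w → + D₁ w v) + - H * + D₁ u v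
      ≡⟨ cong₂ (λ s h → c i * s + - h * + D₁ u v) (sumA-column iu bv) (sym (c*h≡H iu)) ⟩
    c i * (hℤ i * (+ D₁ u v + + D₂ u v)) + - (c i * hℤ i) * + D₁ u v
      ≡⟨ regroup (c i) (hℤ i) (+ D₁ u v) (+ D₂ u v) ⟩
    + D₂ u v * (c i * hℤ i)                               ≡⟨ cong (+ D₂ u v *_) (c*h≡H iu) ⟩
    + D₂ u v * H                                          ≡⟨ sym (column-B bv (λ w → + D₂ u w)) ⟩
    sumFin (λ w → + D₂ u w * P w v)                       ∎
    where
    open ≡-Reasoning
    regroup : ∀ c h d₁ d₂ → c * (h * (d₁ + d₂)) + - (c * h) * d₁ ≡ d₂ * (c * h)
    regroup = solve-∀

  intertwine-AA : ∀ {i k u v} → IsA i u → IsA k v → Intertwines u v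
  intertwine-AA {i} {k} {u} {v} iu kv =
    trans (row-A iu (λ w → + D₁ w v)) (trans (same-ends (i ≟ k)) (sym (column-A kv (λ w → + D₂ u w))))
    where
    open ≡-Reasoning
    same-ends : Dec (i ≡ k) → c i * sumA i (λ w → + D₁ w v) + - H * + D₁ u v ≡ c k * sumA k (λ w → + D₂ u w) + + D₂ u v * - H
    same-ends (yes refl) = begin
      c i * sumA i (λ w → + D₁ w v) + - H * + D₁ u v
        ≡⟨ cong₂ (λ s d → c i * s + - H * + d) same-sums (D₁≡D₂-AA (i , iu) (i , kv)) ⟩
      c i * sumA i (λ w → + D₂ u w) + - H * + D₂ u v
        ≡⟨ cong (_+_ (c i * sumA i (λ w → + D₂ u w))) (ℤP.*-comm (- H) (+ D₂ u v)) ⟩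
      c i * sumA i (λ w → + D₂ u w) + + D₂ u v * - H ∎
      where
      same-sums : sumA i (λ w → + D₁ w v) ≡ sumA i (λ w → + D₂ u w)
      same-sums = begin
        sumA i (λ w → + D₁ w v)   ≡⟨ sumOver-cong (isA i) (λ w _ → cong +_ (M₁.D-sym w v)) ⟩
        sumA i (λ w → + D₁ v w)   ≡⟨ trans (sumA-A kv) (sym (sumA-A iu)) ⟩
        sumA i (λ w → + D₁ u w)   ≡⟨ sumOver-cong (isA i) (λ w aw → cong +_ (D₁≡D₂-AA (i , iu) (i , isA⇒IsA aw))) ⟩
        sumA i (λ w → + D₂ u w)   ∎
    same-ends (no i≢k) = begin
      c i * sumA i (λ w → + D₁ w v) + - H * + D₁ u v
        ≡⟨ cong (λ s → c i * s + - H * + D₁ u v) sum₁ ⟩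
      c i * ((hℤ i + hℤ i) * + D₁ u v) + - H * + D₁ u v
        ≡⟨ cong (λ h → c i * ((hℤ i + hℤ i) * + D₁ u v) + - h * + D₁ u v) (sym (c*h≡H iu)) ⟩
      c i * ((hℤ i + hℤ i) * + D₁ u v) + - (c i * hℤ i) * + D₁ u v
        ≡⟨ twice-minus-once (c i) (hℤ i) (+ D₁ u v) ⟩
      c i * hℤ i * + D₁ u v
        ≡⟨ trans (cong (_* + D₁ u v) (trans (c*h≡H iu) (sym (c*h≡H kv)))) (sym (twice-minus-once (c k) (hℤ k) (+ D₁ u v))) ⟩
      c k * ((hℤ k + hℤ k) * + D₁ u v) + - (c k * hℤ k) * + D₁ u v
        ≡⟨ cong₂ (λ s h → c k * s + h) (sym sum₂) (trans (cong (λ h → - h * + D₁ u v) (c*h≡H kv))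
                                                          (trans (ℤP.*-comm (- H) _) (cong (λ d → + d * - H) (D₁≡D₂-AA (i , iu) (k , kv))))) ⟩
      c k * sumA k (λ w → + D₂ u w) + + D₂ u v * - H ∎
      where
      twice-minus-once : ∀ c h d → c * ((h + h) * d) + - (c * h) * d ≡ c * h * d
      twice-minus-once = solve-∀
      sum₁ : sumA i (λ w → + D₁ w v) ≡ (hℤ i + hℤ i) * + D₁ u v
      sum₁ = sumA-const i (+ D₁ u v) (λ w iw → cong +_ (D₂≤D₁.A-equidistant (IsA⇒¬InBlock kv (i≢k ∘ sym)) iw iu))
      sum₂ : sumA k (λ w → + D₂ u w) ≡ (hℤ k + hℤ k) * + D₁ u v
      sum₂ = sumA-const k (+ D₁ u v) λ w kw → cong +_ (begin
        D₂ u w   ≡⟨ sym (D₁≡D₂-AA (i , iu) (k , kw)) ⟩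
        D₁ u w   ≡⟨ M₁.D-sym u w ⟩
        D₁ w u   ≡⟨ D₂≤D₁.A-equidistant (IsA⇒¬InBlock iu i≢k) kw kv ⟩
        D₁ v u   ≡⟨ M₁.D-sym v u ⟩
        D₁ u v   ∎)

  P-intertwines : ∀ u v → Intertwines u v
  P-intertwines u v with kind u | kind v
  ... | kB _ _ bu | kB _ _ bv = intertwine-BB bu bv
  ... | kB _ _ bu | kA _ kv   = intertwine-BA bu kv
  ... | kA _ iu   | kB _ _ bv = intertwine-AB iu bv
  ... | kA _ iu   | kA _ kv   = intertwine-AA iu kv

  P²-B : ∀ {i j u} → IsB i j u → ∀ v → sumFin (λ w → P u w * P w v) ≡ (H * H) * δ u v
  P²-B {u = u} bu v = begin
    sumFin (λ w → P u w * P w v)                        ≡⟨ row-B bu (λ w → P w v) ⟩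
    H * (𝟙 (sameA u v) * weight u + diagonal u * δ u v) ≡⟨ cong₂ (λ a d → H * (𝟙 a * weight u + d * δ u v)) (sameA-B bu v) (diagonal-B bu) ⟩
    H * (0ℤ * weight u + H * δ u v)                     ≡⟨ cong (H *_) (ℤP.+-identityˡ (H * δ u v)) ⟩
    H * (H * δ u v)                                     ≡⟨ sym (ℤP.*-assoc H H (δ u v)) ⟩
    H * H * δ u v                                       ∎
    where open ≡-Reasoning

  P²-A : ∀ {i u} → IsA i u → ∀ v → sumFin (λ w → P u w * P w v) ≡ (H * H) * δ u v
  P²-A {i} {u} iu v = begin
    sumFin (λ w → P u w * P w v)                            ≡⟨ row-A iu (λ w → P w v) ⟩
    c i * sumA i (λ w → P w v) + - H * P u v                ≡⟨ cong₂ (λ s p → c i * s + - H * p) column-sum (P-A iu) ⟩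
    c i * ((hℤ i + hℤ i) * (a * c i) + - H * a) + - H * (a * c i + - H * δ u v)
      ≡⟨ cong (λ h → c i * ((hℤ i + hℤ i) * (a * c i) + - h * a) + - h * (a * c i + - h * δ u v)) (sym (c*h≡H iu)) ⟩
    c i * ((hℤ i + hℤ i) * (a * c i) + - (c i * hℤ i) * a) + - (c i * hℤ i) * (a * c i + - (c i * hℤ i) * δ u v)
      ≡⟨ square (c i) (hℤ i) a (δ u v) ⟩
    c i * hℤ i * (c i * hℤ i) * δ u v                       ≡⟨ cong (λ h → h * h * δ u v) (c*h≡H iu) ⟩
    H * H * δ u v                                           ∎
    where
    open ≡-Reasoning
    a = 𝟙 (isA i v)
    square : ∀ c h a d → c * ((h + h) * (a * c) + - (c * h) * a) + - (c * h) * (a * c + - (c * h) * d) ≡ (c * h) * (c * h) * d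
    square = solve-∀
    P-A : ∀ {w} → IsA i w → P w v ≡ a * c i + - H * δ w v
    P-A {w} iw = trans (cong₂ (λ s x → 𝟙 s * x + diagonal w * δ w v) (sameA-A iw v) (weight-A iw))
                       (cong (λ d → a * c i + d * δ w v) (diagonal-A iw))
    column-sum : sumA i (λ w → P w v) ≡ (hℤ i + hℤ i) * (a * c i) + - H * a
    column-sum = begin
      sumA i (λ w → P w v)                                 ≡⟨ sumOver-cong (isA i) (λ w aw → P-A (isA⇒IsA aw)) ⟩
      sumA i (λ w → a * c i + - H * δ w v)                 ≡⟨ sumOver-+ (isA i) (λ _ → a * c i) (λ w → - H * δ w v) ⟩
      sumA i (λ _ → a * c i) + sumA i (λ w → - H * δ w v)  ≡⟨ cong₂ _+_ (sumA-const i (a * c i) (λ _ _ → refl))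
                                                                (trans (sumOver-* (isA i) (- H) (λ w → δ w v))
                                                                       (cong (- H *_) (sumFin-δʳ v (λ w → 𝟙 (isA i w))))) ⟩
      (hℤ i + hℤ i) * (a * c i) + - H * a                  ∎

  P²≡H²I : ∀ u v → sumFin (λ w → P u w * P w v) ≡ (H * H) * δ u v
  P²≡H²I u v with kind u
  ... | kB _ _ bu = P²-B bu v
  ... | kA _ iu   = P²-A iu v

theorem2p4 : ∀ {n m : ℕ} {ℓ : Fin m → ℕ}
    (part : Fin n → Part m ℓ)
    (sel : (i : Fin m) → Fin (ℓ i) → Fin n → Bool)
    (G₁ : Adj n) →
    Construction.Hypotheses part sel G₁ →
    DistanceCospectral G₁ (Construction.G₂ part sel G₁)
theorem2p4 part sel G₁ hyp D₁ D₂ isD₁ isD₂ =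
  det-shift-conjugate P (λ r c → + D₁ r c) (λ r c → + D₂ r c) (H * H) H²≢0 P²≡H²I P-intertwines
  where
  open import Data.Integer using (+_; _*_; 0ℤ)
  open import Data.Integer.Properties using (i*j≡0⇒i≡0∨j≡0)
  open import Data.Sum using ([_,_])
  open import Relation.Nullary using (¬_)
  open import Relation.Binary.PropositionalEquality using (_≡_)
  open DeterminantProduct using (det-shift-conjugate)
  open SwitchingMatrix part sel G₁ hyp D₁ D₂ isD₁ isD₂ using (P; H; H≢0; P²≡H²I; P-intertwines)
  H²≢0 : ¬ H * H ≡ 0ℤ
  H²≢0 H²≡0 = [ H≢0 , H≢0 ] (i*j≡0⇒i≡0∨j≡0 H H²≡0)
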